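{- Let $G$ be a finite simple hypergraph. Then $H^i(\mathcal L(G))$ is finite dimensional for every $i\ge0$.
   Context: A hypergraph $G$ consists of a set $V(G)$ of vertices and, for each $k>0$, a collection $E_k(G)$ of $k$-element subsets of $V(G)$ (the $k$-edges); $E(G)=\bigcup_kE_k(G)$. $G$ is finite if $V(G)$ is finite, and simple if any two distinct edges have nonempty symmetric difference. $H^\bullet(\mathcal L(G))$ denotes the cohomology of the Maurer–Cartan algebra $C^\bullet(\mathcal L(G))$ of the 2-step nilpotent $L_\infty$-algebra of $G$. Concretely, fixing an order on $V(G)$, $C^\bullet(\mathcal L(G))$ is the free graded-commutative real algebra (odd-degree generators anticommute and square to zero, even-degree generators are polynomial variables) on generators $x_i^*$ ($i\in V(G)$) of degree $1$ and $x_I^*$ ($I\in E(G)$) of degree $|I|-1$, with differential $d$ the degree-one derivation determined by $dx_i^*=0$ and $dx_I^*=x_{i_1}^*\cdots x_{i_k}^*$ for $I=\{i_1<\cdots<i_k\}$. $H^i(\mathcal L(G))$ is its cohomology in degree $i$.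
   Formalization: The Maurer–Cartan algebra $C^\bullet(\mathcal L(G))$ is taken with rational rather than real coefficients, so $H^i(\mathcal L(G))$ is a vector space over ℚ. -}

module Defs where

open import Data.Nat using (ℕ; zero; suc; _+_; _*_; _∸_)
open import Data.Bool using (Bool; true; false; if_then_else_)
open import Data.Fin as Fin using (Fin; splitAt; _↑ˡ_; _↑ʳ_)
open import Data.Fin.Properties using (<-cmp)
open import Data.Fin.Subset using (Subset; ∣_∣; Nonempty; _∈_)
open import Data.Fin.Subset.Properties using (_∈?_)
open import Data.List using (List; []; _∷_; _++_; map; filter; length; lookup; concatMap; zipWith; allFin)
open import Data.List.Properties using (≡-dec)
open import Data.List.Relation.Unary.All using (All)
open import Data.List.Relation.Unary.Unique.Propositional using (Unique)
open import Data.Maybe using (Maybe; just; nothing)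
open import Data.Product using (_×_; _,_; ∃)
open import Data.Sum using (inj₁; inj₂)
open import Data.Rational using (ℚ; 0ℚ; 1ℚ; -_) renaming (_+_ to _+ℚ_; _*_ to _*ℚ_)
open import Relation.Binary.Definitions using (tri<; tri≈; tri>)
open import Relation.Binary.PropositionalEquality using (_≡_)
open import Relation.Nullary using (yes; no)

record Hypergraph : Set where
  field
    n        : ℕ
    edges    : List (Subset n)
    simple   : Unique edges
    nonempty : All Nonempty edges

  m : ℕ
  m = length edges

  -- generators of the Maurer–Cartan algebra: the first n are x_i^*
  -- (i a vertex), the last m are x_I^* (I an edge), ordered by Fin.
  Gen : Set
  Gen = Fin (n + m)

  elems : Subset n → List (Fin n)
  elems p = filter (_∈? p) (allFin n)

  deg : Gen → ℕ
  deg g with splitAt n g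
  ... | inj₁ _ = 1
  ... | inj₂ e = ∣ lookup edges e ∣ ∸ 1

  -- the differential of a generator, as a word (nothing = 0):
  -- d x_i^* = 0,  d x_I^* = x_{i1}^* ⋯ x_{ik}^*  with i1 < ⋯ < ik
  dGen : Gen → Maybe (List Gen)
  dGen g with splitAt n g
  ... | inj₁ _ = nothing
  ... | inj₂ e = just (map (_↑ˡ m) (elems (lookup edges e)))

open Hypergraph public

isOdd : ℕ → Bool
isOdd zero = false
isOdd (suc zero) = true
isOdd (suc (suc k)) = isOdd k

sgn : ℕ → ℚ
sgn k = if isOdd k then - 1ℚ else 1ℚ

-- The free graded-commutative ℚ-algebra C(G) on the generators.
-- An element is represented by a formal linear combination of words
-- (finite lists of generators, read as ordered products).  Two
-- representatives are equal in C(G) iff, after bringing every word to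
-- its canonical form (generators sorted increasingly, Koszul signs
-- (-1)^{|a||b|} for each transposition, words with a repeated
-- odd-degree generator being 0), all coefficients agree.

module _ (G : Hypergraph) where

  Word : Set
  Word = List (Gen G)

  Combo : Set
  Combo = List (ℚ × Word)

  degW : Word → ℕ
  degW [] = 0
  degW (g ∷ w) = deg G g + degW w

  -- insert a generator into a sorted word, with sign; nothing = 0
  insertG : Gen G → Word → Maybe (ℚ × Word)
  insertG g [] = just (1ℚ , g ∷ [])
  insertG g (h ∷ t) with <-cmp g h
  ... | tri< _ _ _ = just (1ℚ , g ∷ h ∷ t)
  ... | tri≈ _ _ _ = if isOdd (deg G g) then nothing else just (1ℚ , g ∷ h ∷ t)
  ... | tri> _ _ _ with insertG g t
  ...   | nothing = nothing
  ...   | just (s , t') = just (sgn (deg G g * deg G h) *ℚ s , h ∷ t')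

  -- canonical form of a word: sign and sorted word, or nothing (= 0)
  normalize : Word → Maybe (ℚ × Word)
  normalize [] = just (1ℚ , [])
  normalize (g ∷ w) with normalize w
  ... | nothing = nothing
  ... | just (s , w') with insertG g w'
  ...   | nothing = nothing
  ...   | just (s' , w'') = just (s *ℚ s' , w'')

  coeff : Combo → Word → ℚ
  coeff [] mon = 0ℚ
  coeff ((c , w) ∷ p) mon with normalize w
  ... | nothing = coeff p mon
  ... | just (s , w') with ≡-dec Fin._≟_ w' mon
  ...   | yes _ = (c *ℚ s) +ℚ coeff p mon
  ...   | no _ = coeff p mon

  _≈C_ : Combo → Combo → Set
  p ≈C q = ∀ (mon : Word) → coeff p mon ≡ coeff q mon

  scale : ℚ → Combo → Combo
  scale a = map (λ { (c , w) → (a *ℚ c , w) })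

  dWord : Word → Combo
  dWord [] = []
  dWord (g ∷ w) = dg ++ map (λ { (c , v) → (sgn (deg G g) *ℚ c , g ∷ v) }) (dWord w)
    where
    dg : Combo
    dg with dGen G g
    ... | nothing = []
    ... | just u = (1ℚ , u ++ w) ∷ []

  d : Combo → Combo
  d = concatMap (λ { (c , w) → scale c (dWord w) })

  Homog : ℕ → Combo → Set
  Homog i p = All (λ t → degW (Data.Product.proj₂ t) ≡ i) p

  Cocycle : ℕ → Combo → Set
  Cocycle i z = Homog i z × (d z ≈C [])

  lincomb : List ℚ → List Combo → Combo
  lincomb as cs = concatMap (λ x → x) (zipWith scale as cs)

  -- H^i(L(G)) is finite dimensional: finitely many degree-i cocycles
  -- whose classes span H^i, i.e. every degree-i cocycle is a linear
  -- combination of them modulo a coboundary.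
  FinDimH : ℕ → Set
  FinDimH i = ∃ λ (cs : List Combo) →
    All (Cocycle i) cs ×
    (∀ (z : Combo) → Cocycle i z →
      ∃ λ (as : List ℚ) → ∃ λ (b : Combo) → z ≈C (lincomb as cs ++ d b))

{-# OPTIONS --safe #-}

-- Call an edge {v} with one vertex a unit edge, let h
-- (homotopy) be the odd derivation sending x_v to x_{v} when {v} is a unit edge and every other
-- generator to 0, and let units w count the letters of w of the form x_v or x_{v} with {v} a unit
-- edge.  Then d never lowers units, h preserves it, and on words with k units the units-preserving
-- part of dh + hd is multiplication by k (an Euler formula).  Hence if all words of a cocycle u
-- have at least k > 0 units, subtracting d(h(u_k))/k, where u_k is the part of u with exactly k
-- units, leaves a cocycle all of whose words have at least k + 1 units.  Since units w is bounded
-- by the size of w (its letters weighted by their numbers of vertices), which d and h preserve,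
-- such cocycles are coboundaries.  A word of degree i without units has size at most n·i, so up to
-- a coboundary every degree-i cocycle is supported on the finitely many words of degree i and size
-- at most n·i, where the cocycle condition is a finite linear system; Gaussian elimination yields a
-- finite spanning set of its solutions.

module Submission where

open import Defs
open import Data.Bool using (Bool; true; false; not; _∧_; _xor_)
open import Data.Empty using (⊥-elim)
open import Data.Unit using (⊤; tt)
open import Data.Fin as Fin using (Fin; _<_; _↑ˡ_; _↑ʳ_; splitAt)
open import Data.Fin.Properties as FinP using (<-cmp)
open import Data.Fin.Subset using (Subset; ∣_∣; _⊆_)
open import Data.Fin.Subset.Properties using (_∈?_; ⊆-antisym)
open import Data.List as List using (List; []; _∷_; _++_; map; filter; tabulate)
import Data.List.Properties as ListP
open import Data.List.Membership.Propositional using (_∈_; _∉_; find)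
open import Data.List.Membership.Propositional.Properties using (∈-filter⁺; ∈-filter⁻; ∈-allFin; ∈-lookup; ∈-map⁺; ∈-concatMap⁺)
open import Data.List.Relation.Unary.Any as Any using (here; there)
import Data.List.Relation.Unary.Any.Properties as AnyP
open import Data.List.Relation.Unary.Unique.Propositional using (Unique)
open import Data.List.Relation.Unary.AllPairs using () renaming (_∷_ to _∷ᵘ_)
open import Data.List.Relation.Unary.All as All using (All; []; _∷_; all?)
import Data.List.Relation.Unary.All.Properties as AllP
open import Data.Nat as ℕ using (ℕ; zero; suc; _∸_)
import Data.Nat.Properties as ℕP
import Algebra.Properties.CommutativeSemigroup ℕP.+-commutativeSemigroup as ℕ+
open import Data.Product using (Σ; _×_; _,_; proj₁; proj₂)
open import Data.Rational as ℚ using (ℚ; 0ℚ; 1ℚ; _+_; _*_; -_; _-_; NonZero)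
import Data.Rational.Properties as ℚP
open import Data.Rational.Solver using (module +-*-Solver)
import Data.Vec as Vec
open import Data.Sum using (_⊎_; inj₁; inj₂)
open import Data.Maybe as Maybe using (Maybe; just; nothing)
open import Level using (0ℓ)
open import Relation.Binary.Bundles using (Setoid)
open import Relation.Binary.Definitions using (DecidableEquality; tri<; tri≈; tri>)
import Relation.Binary.Reasoning.Setoid as SetoidReasoning
open import Relation.Binary.PropositionalEquality
open import Relation.Nullary using (yes; no; ¬_; ¬?)
open import Relation.Unary using (Decidable)

open +-*-Solver

fromℕ : ℕ → ℚ
fromℕ zero = 0ℚ
fromℕ (suc k) = 1ℚ + fromℕ k

fromℕ-+ : ∀ a b → fromℕ (a ℕ.+ b) ≡ fromℕ a + fromℕ b
fromℕ-+ zero b = sym (ℚP.+-identityˡ (fromℕ b))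
fromℕ-+ (suc a) b = trans (cong (1ℚ +_) (fromℕ-+ a b)) (sym (ℚP.+-assoc 1ℚ (fromℕ a) (fromℕ b)))

fromℕ-nonNegative : ∀ k → ℚ.NonNegative (fromℕ k)
fromℕ-nonNegative zero = _
fromℕ-nonNegative (suc k) = ℚP.nonNeg+nonNeg⇒nonNeg 1ℚ (fromℕ k) {{fromℕ-nonNegative k}}

fromℕ-suc-nonZero : ∀ k → NonZero (fromℕ (suc k))
fromℕ-suc-nonZero k = ℚP.pos⇒nonZero (fromℕ (suc k)) {{ℚP.pos+nonNeg⇒pos 1ℚ (fromℕ k) {{fromℕ-nonNegative k}}}}

isOdd-suc : ∀ a → isOdd (suc a) ≡ not (isOdd a)
isOdd-suc zero = refl
isOdd-suc (suc a) rewrite isOdd-suc a with isOdd a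
... | true = refl
... | false = refl

isOdd-+ : ∀ a b → isOdd (a ℕ.+ b) ≡ isOdd a xor isOdd b
isOdd-+ zero b = refl
isOdd-+ (suc a) b rewrite isOdd-suc (a ℕ.+ b) | isOdd-suc a | isOdd-+ a b with isOdd a | isOdd b
... | true | true = refl
... | true | false = refl
... | false | true = refl
... | false | false = refl

isOdd-* : ∀ a b → isOdd (a ℕ.* b) ≡ isOdd a ∧ isOdd b
isOdd-* zero b = refl
isOdd-* (suc a) b rewrite isOdd-+ b (a ℕ.* b) | isOdd-suc a | isOdd-* a b with isOdd a | isOdd b
... | true | true = refl
... | true | false = refl
... | false | true = refl
... | false | false = refl

sgn-+ : ∀ a b → sgn (a ℕ.+ b) ≡ sgn a * sgn b
sgn-+ a b rewrite isOdd-+ a b with isOdd a | isOdd b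
... | true | true = refl
... | true | false = refl
... | false | true = refl
... | false | false = refl

sgn-sq : ∀ k → sgn k * sgn k ≡ 1ℚ
sgn-sq k with isOdd k
... | true = refl
... | false = refl

sgn-even : ∀ a → isOdd a ≡ false → sgn a ≡ 1ℚ
sgn-even a e rewrite e = refl

sgn-*-opposite-parity : ∀ a b c → isOdd c ≡ not (isOdd a) → sgn (b ℕ.* c) ≡ sgn (a ℕ.* b) * sgn b
sgn-*-opposite-parity a b c odd-c
  rewrite isOdd-* b c | odd-c | isOdd-* a b with isOdd a | isOdd b
... | true | true = refl
... | true | false = refl
... | false | true = refl
... | false | false = refl

-- Gaussian elimination

Vector : ℕ → Set
Vector r = Fin r → ℚ

∑ : ∀ r → Vector r → ℚ
∑ zero f = 0ℚ
∑ (suc r) f = f Fin.zero + ∑ r (λ j → f (Fin.suc j))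

∑-cong : ∀ r {f g : Vector r} → (∀ j → f j ≡ g j) → ∑ r f ≡ ∑ r g
∑-cong zero f≗g = refl
∑-cong (suc r) f≗g = cong₂ _+_ (f≗g Fin.zero) (∑-cong r (λ j → f≗g (Fin.suc j)))

∑-+ : ∀ r (f g : Vector r) → ∑ r (λ j → f j + g j) ≡ ∑ r f + ∑ r g
∑-+ zero f g = sym (ℚP.+-identityˡ 0ℚ)
∑-+ (suc r) f g = trans (cong (f Fin.zero + g Fin.zero +_) (∑-+ r _ _))
  (solve 4 (λ a b c d → (a :+ b) :+ (c :+ d) := (a :+ c) :+ (b :+ d)) refl
     (f Fin.zero) (g Fin.zero) (∑ r (λ j → f (Fin.suc j))) (∑ r (λ j → g (Fin.suc j))))

∑-* : ∀ r c (f : Vector r) → ∑ r (λ j → c * f j) ≡ c * ∑ r f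
∑-* zero c f = sym (ℚP.*-zeroʳ c)
∑-* (suc r) c f = trans (cong (c * f Fin.zero +_) (∑-* r c _)) (sym (ℚP.*-distribˡ-+ c _ _))

∑-0 : ∀ r {f : Vector r} → (∀ j → f j ≡ 0ℚ) → ∑ r f ≡ 0ℚ
∑-0 zero f≗0 = refl
∑-0 (suc r) f≗0 = trans (cong₂ _+_ (f≗0 Fin.zero) (∑-0 r (λ j → f≗0 (Fin.suc j)))) (ℚP.+-identityˡ 0ℚ)

infix 9 _·_
_·_ : ∀ {r} → Vector r → Vector r → ℚ
_·_ {r} F a = ∑ r (λ j → a j * F j)

·-cong : ∀ {r} (F : Vector r) {a a′} → (∀ j → a j ≡ a′ j) → F · a ≡ F · a′
·-cong {r} F a≗a′ = ∑-cong r (λ j → cong (_* F j) (a≗a′ j))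

·-zeroˡ : ∀ {r} (F a : Vector r) → (∀ j → F j ≡ 0ℚ) → F · a ≡ 0ℚ
·-zeroˡ F a F≗0 = ∑-0 _ (λ j → trans (cong (a j *_) (F≗0 j)) (ℚP.*-zeroʳ (a j)))

weighted : List ℚ → List ℚ → ℚ
weighted (b ∷ bs) (x ∷ xs) = b * x + weighted bs xs
weighted _ _ = 0ℚ

combination : ∀ {r} → List ℚ → List (Vector r) → Vector r
combination bs S j = weighted bs (map (λ s → s j) S)

Spans : ∀ {r} → List (Vector r) → Vector r → Set
Spans S a = Σ (List ℚ) (λ bs → ∀ j → a j ≡ combination bs S j)

Annihilates : ∀ {r} → Vector r → List (Vector r) → Set
Annihilates F S = All (λ s → F · s ≡ 0ℚ) S

·-combination : ∀ {r} (F : Vector r) bs S → F · combination bs S ≡ weighted bs (map (F ·_) S)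
·-combination F [] S = ∑-0 _ (λ j → ℚP.*-zeroˡ (F j))
·-combination F (b ∷ bs) [] = ∑-0 _ (λ j → ℚP.*-zeroˡ (F j))
·-combination {r} F (b ∷ bs) (s ∷ S) = begin
  ∑ r (λ j → (b * s j + combination bs S j) * F j)        ≡⟨ ∑-cong r (λ j → distrib b (s j) (combination bs S j) (F j)) ⟩
  ∑ r (λ j → b * (s j * F j) + combination bs S j * F j)  ≡⟨ ∑-+ r _ _ ⟩
  ∑ r (λ j → b * (s j * F j)) + F · combination bs S       ≡⟨ cong₂ _+_ (∑-* r b _) (·-combination F bs S) ⟩
  b * F · s + weighted bs (map (F ·_) S)                   ∎
  where
  open ≡-Reasoning
  distrib : ∀ b x y f → (b * x + y) * f ≡ b * (x * f) + y * f
  distrib = solve 4 (λ b x y f → (b :* x :+ y) :* f := b :* (x :* f) :+ y :* f) refl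

module Elimination {r : ℕ} (F : Vector r) where

  module Pivot (t : Vector r) (Ft≢0 : ¬ F · t ≡ 0ℚ) where

    ι : ℚ
    ι = (ℚ.1/ (F · t)) {{ℚ.≢-nonZero Ft≢0}}

    coefficient : Vector r → ℚ
    coefficient s = - (F · s * ι)

    project : Vector r → Vector r
    project s j = s j + coefficient s * t j

    ·-project : ∀ (F′ : Vector r) s → F′ · project s ≡ F′ · s + coefficient s * F′ · t
    ·-project F′ s = trans (∑-cong r (λ j → distrib (s j) (coefficient s) (t j) (F′ j)))
                           (trans (∑-+ r _ _) (cong (F′ · s +_) (∑-* r (coefficient s) _)))
      where
      distrib : ∀ x c y g → (x + c * y) * g ≡ x * g + c * (y * g)
      distrib = solve 4 (λ x c y g → (x :+ c :* y) :* g := x :* g :+ c :* (y :* g)) refl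

    project-annihilated : ∀ s → F · project s ≡ 0ℚ
    project-annihilated s = begin
      F · project s                        ≡⟨ ·-project F s ⟩
      F · s + - (F · s * ι) * F · t        ≡⟨ solve 3 (λ x i y → x :+ (:- (x :* i)) :* y := x :- x :* (i :* y)) refl (F · s) ι (F · t) ⟩
      F · s - F · s * (ι * F · t)          ≡⟨ cong (λ x → F · s - F · s * x) (ℚP.*-inverseˡ (F · t) {{ℚ.≢-nonZero Ft≢0}}) ⟩
      F · s - F · s * 1ℚ                   ≡⟨ solve 1 (λ x → x :- x :* con 1ℚ := con 0ℚ) refl (F · s) ⟩
      0ℚ                                   ∎
      where open ≡-Reasoning

    project-preserves : ∀ (F′ : Vector r) s → F′ · s ≡ 0ℚ → F′ · t ≡ 0ℚ → F′ · project s ≡ 0ℚ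
    project-preserves F′ s F′s≡0 F′t≡0 = begin
      F′ · project s                     ≡⟨ ·-project F′ s ⟩
      F′ · s + coefficient s * F′ · t    ≡⟨ cong₂ (λ x y → x + coefficient s * y) F′s≡0 F′t≡0 ⟩
      0ℚ + coefficient s * 0ℚ            ≡⟨ solve 1 (λ c → con 0ℚ :+ c :* con 0ℚ := con 0ℚ) refl (coefficient s) ⟩
      0ℚ                                 ∎
      where open ≡-Reasoning

    combination-project : ∀ bs S j → combination bs (map project S) j ≡ combination bs S j + weighted bs (map coefficient S) * t j
    combination-project [] S j = sym (trans (cong (0ℚ +_) (ℚP.*-zeroˡ (t j))) (ℚP.+-identityˡ 0ℚ))
    combination-project (b ∷ bs) [] j = sym (trans (cong (0ℚ +_) (ℚP.*-zeroˡ (t j))) (ℚP.+-identityˡ 0ℚ))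
    combination-project (b ∷ bs) (s ∷ S) j = trans (cong (b * project s j +_) (combination-project bs S j))
      (solve 6 (λ b x c y L M → b :* (x :+ c :* y) :+ (L :+ M :* y) := (b :* x :+ L) :+ (b :* c :+ M) :* y) refl
         b (s j) (coefficient s) (t j) (combination bs S j) (weighted bs (map coefficient S)))

    weighted-coefficient : ∀ bs S → weighted bs (map coefficient S) ≡ - (weighted bs (map (F ·_) S) * ι)
    weighted-coefficient [] S = sym (cong -_ (ℚP.*-zeroˡ ι))
    weighted-coefficient (b ∷ bs) [] = sym (cong -_ (ℚP.*-zeroˡ ι))
    weighted-coefficient (b ∷ bs) (s ∷ S) = trans (cong (b * coefficient s +_) (weighted-coefficient bs S))
      (solve 4 (λ b d i L → b :* (:- (d :* i)) :+ (:- (L :* i)) := :- ((b :* d :+ L) :* i)) refl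
         b (F · s) ι (weighted bs (map (F ·_) S)))

    project-spans : ∀ S a → Spans S a → F · a ≡ 0ℚ → Spans (map project S) a
    project-spans S a (bs , a≗) Fa≡0 = bs , λ j → begin
      a j                                                            ≡⟨ a≗ j ⟩
      combination bs S j                                             ≡⟨ solve 3 (λ x i y → x := x :+ (:- (con 0ℚ :* i)) :* y) refl (combination bs S j) ι (t j) ⟩
      combination bs S j + - (0ℚ * ι) * t j                          ≡⟨ cong (λ x → combination bs S j + - (x * ι) * t j) (sym weighted≡0) ⟩
      combination bs S j + - (weighted bs (map (F ·_) S) * ι) * t j  ≡⟨ cong (λ x → combination bs S j + x * t j) (sym (weighted-coefficient bs S)) ⟩
      combination bs S j + weighted bs (map coefficient S) * t j     ≡⟨ sym (combination-project bs S j) ⟩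
      combination bs (map project S) j                               ∎
      where
      open ≡-Reasoning
      weighted≡0 : weighted bs (map (F ·_) S) ≡ 0ℚ
      weighted≡0 = trans (sym (·-combination F bs S)) (trans (sym (·-cong F a≗)) Fa≡0)

  pivot? : ∀ S → Annihilates F S ⊎ Σ (Vector r) (λ t → t ∈ S × ¬ F · t ≡ 0ℚ)
  pivot? S with all? (λ s → F · s ℚ.≟ 0ℚ) S
  ... | yes ann = inj₁ ann
  ... | no ¬ann = inj₂ (find (AllP.¬All⇒Any¬ (λ s → F · s ℚ.≟ 0ℚ) S ¬ann))

  step : List (Vector r) → List (Vector r)
  step S with pivot? S
  ... | inj₁ _ = S
  ... | inj₂ (t , _ , Ft≢0) = map (Pivot.project t Ft≢0) S

  step-annihilated : ∀ S → Annihilates F (step S)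
  step-annihilated S with pivot? S
  ... | inj₁ ann = ann
  ... | inj₂ (t , _ , Ft≢0) = AllP.map⁺ (All.universal (Pivot.project-annihilated t Ft≢0) S)

  step-preserves : ∀ (F′ : Vector r) S → Annihilates F′ S → Annihilates F′ (step S)
  step-preserves F′ S ann with pivot? S
  ... | inj₁ _ = ann
  ... | inj₂ (t , t∈S , Ft≢0) =
    AllP.map⁺ (All.map (λ {s} F′s≡0 → Pivot.project-preserves t Ft≢0 F′ s F′s≡0 (All.lookup ann t∈S)) ann)

  step-spans : ∀ S a → Spans S a → F · a ≡ 0ℚ → Spans (step S) a
  step-spans S a spans Fa≡0 with pivot? S
  ... | inj₁ _ = spans
  ... | inj₂ (t , _ , Ft≢0) = Pivot.project-spans t Ft≢0 S a spans Fa≡0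

eliminate : ∀ {r} → List (Vector r) → List (Vector r) → List (Vector r)
eliminate [] S = S
eliminate (F ∷ Fs) S = eliminate Fs (Elimination.step F S)

eliminate-preserves : ∀ {r} (F′ : Vector r) Fs S → Annihilates F′ S → Annihilates F′ (eliminate Fs S)
eliminate-preserves F′ [] S ann = ann
eliminate-preserves F′ (F ∷ Fs) S ann = eliminate-preserves F′ Fs _ (Elimination.step-preserves F F′ S ann)

eliminate-annihilated : ∀ {r} (Fs : List (Vector r)) S → All (λ F → Annihilates F (eliminate Fs S)) Fs
eliminate-annihilated [] S = []
eliminate-annihilated (F ∷ Fs) S =
  eliminate-preserves F Fs _ (Elimination.step-annihilated F S) ∷ eliminate-annihilated Fs _

eliminate-spans : ∀ {r} (Fs : List (Vector r)) S a → Spans S a → All (λ F → F · a ≡ 0ℚ) Fs → Spans (eliminate Fs S) a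
eliminate-spans [] S a spans _ = spans
eliminate-spans (F ∷ Fs) S a spans (Fa≡0 ∷ Fsa≡0) =
  eliminate-spans Fs _ a (Elimination.step-spans F S a spans Fa≡0) Fsa≡0

unit : ∀ {r} → Fin r → Vector r
unit i j with i FinP.≟ j
... | yes _ = 1ℚ
... | no _ = 0ℚ

unit-suc : ∀ {r} (i j : Fin r) → unit (Fin.suc i) (Fin.suc j) ≡ unit i j
unit-suc i j with i FinP.≟ j
... | yes _ = refl
... | no _ = refl

weighted-zeros : ∀ bs r → weighted bs (tabulate {n = r} (λ _ → 0ℚ)) ≡ 0ℚ
weighted-zeros [] r = refl
weighted-zeros (b ∷ bs) zero = refl
weighted-zeros (b ∷ bs) (suc r) =
  trans (cong (_+ weighted bs (tabulate {n = r} (λ _ → 0ℚ))) (ℚP.*-zeroʳ b)) (trans (ℚP.+-identityˡ _) (weighted-zeros bs r))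

weighted-units : ∀ r (a : Vector r) j → weighted (tabulate a) (tabulate (λ i → unit i j)) ≡ a j
weighted-units (suc r) a Fin.zero =
  trans (cong₂ _+_ (ℚP.*-identityʳ (a Fin.zero)) (weighted-zeros (tabulate (λ i → a (Fin.suc i))) r)) (ℚP.+-identityʳ _)
weighted-units (suc r) a (Fin.suc j) =
  trans (cong₂ _+_ (ℚP.*-zeroʳ (a Fin.zero))
                   (trans (cong (weighted (tabulate (λ i → a (Fin.suc i)))) (ListP.tabulate-cong (λ i → unit-suc i j)))
                          (weighted-units r (λ i → a (Fin.suc i)) j)))
        (ℚP.+-identityˡ _)

standard-basis-spans : ∀ r (a : Vector r) → Spans (tabulate unit) a
standard-basis-spans r a =
  tabulate a , λ j → sym (trans (cong (weighted (tabulate a)) (ListP.map-tabulate unit (λ s → s j))) (weighted-units r a j))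

kernel-spanning-set : ∀ r (Fs : List (Vector r)) →
  Σ (List (Vector r)) (λ K → All (λ F → Annihilates F K) Fs × (∀ a → All (λ F → F · a ≡ 0ℚ) Fs → Spans K a))
kernel-spanning-set r Fs =
  eliminate Fs (tabulate unit) ,
  eliminate-annihilated Fs (tabulate unit) ,
  λ a Fsa≡0 → eliminate-spans Fs (tabulate unit) a (standard-basis-spans r a) Fsa≡0

-- Matching on <-cmp g h directly would also abstract the comparison inside insertG, after which
-- the insertG-… lemmas below no longer rewrite the goal; this copy of the trichotomy avoids that.
data Order {k} (g h : Fin k) : Set where
  less : g < h → Order g h
  equal : g ≡ h → Order g h
  greater : h < g → Order g h

order : ∀ {k} (g h : Fin k) → Order g h
order g h with <-cmp g h
... | tri< g<h _ _ = less g<h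
... | tri≈ _ g≡h _ = equal g≡h
... | tri> _ _ h<g = greater h<g

length-filter-∈-suc : ∀ {k} (x : Bool) (p : Subset k) xs →
  List.length (filter (_∈? (x Vec.∷ p)) (map Fin.suc xs)) ≡ List.length (filter (_∈? p) xs)
length-filter-∈-suc x p [] = refl
length-filter-∈-suc x p (i ∷ xs) with i ∈? p
... | yes _ = cong suc (length-filter-∈-suc x p xs)
... | no _ = length-filter-∈-suc x p xs

length-filter-∈-tail : ∀ {k} (x : Bool) (p : Subset k) →
  List.length (filter (_∈? (x Vec.∷ p)) (tabulate Fin.suc)) ≡ List.length (filter (_∈? p) (List.allFin k))
length-filter-∈-tail x p =
  trans (cong (λ xs → List.length (filter (_∈? (x Vec.∷ p)) xs)) (sym (ListP.map-tabulate (λ i → i) Fin.suc)))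
        (length-filter-∈-suc x p (List.allFin _))

length-elements : ∀ {k} (p : Subset k) → List.length (filter (_∈? p) (List.allFin k)) ≡ ∣ p ∣
length-elements {zero} Vec.[] = refl
length-elements {suc k} (true Vec.∷ p) = cong suc (trans (length-filter-∈-tail true p) (length-elements p))
length-elements {suc k} (false Vec.∷ p) = trans (length-filter-∈-tail false p) (length-elements p)

elements-injective : ∀ {k} (p q : Subset k) → filter (_∈? p) (List.allFin k) ≡ filter (_∈? q) (List.allFin k) → p ≡ q
elements-injective {k} p q eq = ⊆-antisym (⊆ p q eq) (⊆ q p (sym eq))
  where
  ⊆ : ∀ p q → filter (_∈? p) (List.allFin k) ≡ filter (_∈? q) (List.allFin k) → p ⊆ q
  ⊆ p q eq {x} x∈p = proj₂ (∈-filter⁻ (_∈? q) {xs = List.allFin k} (subst (x ∈_) eq (∈-filter⁺ (_∈? p) (∈-allFin x) x∈p)))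

lookup-injective : ∀ {A : Set} {xs : List A} → Unique xs → ∀ i j → List.lookup xs i ≡ List.lookup xs j → i ≡ j
lookup-injective {xs = x ∷ xs} (x∉xs ∷ᵘ _) Fin.zero Fin.zero eq = refl
lookup-injective {xs = x ∷ xs} (x∉xs ∷ᵘ _) Fin.zero (Fin.suc j) eq = ⊥-elim (All.lookup x∉xs (∈-lookup {xs = xs} j) eq)
lookup-injective {xs = x ∷ xs} (x∉xs ∷ᵘ _) (Fin.suc i) Fin.zero eq = ⊥-elim (All.lookup x∉xs (∈-lookup {xs = xs} i) (sym eq))
lookup-injective {xs = x ∷ xs} (_ ∷ᵘ unique) (Fin.suc i) (Fin.suc j) eq = cong Fin.suc (lookup-injective unique i j eq)

module _ {A : Set} {P : A → Set} (P? : Decidable P) where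

  find-sound : ∀ xs {x} → List.find P? xs ≡ just x → P x
  find-sound (y ∷ xs) eq with P? y
  find-sound (y ∷ xs) refl | yes Py = Py
  ... | no _ = find-sound xs eq

  find-complete : ∀ {xs x} → x ∈ xs → P x → Σ A (λ y → List.find P? xs ≡ just y)
  find-complete {y ∷ xs} x∈ Px with P? y
  ... | yes _ = y , refl
  find-complete {y ∷ xs} (here refl) Px | no ¬Py = ⊥-elim (¬Py Px)
  find-complete {y ∷ xs} (there x∈) Px | no _ = find-complete x∈ Px

module _ (G : Hypergraph) where

  infix 4 _≟ʷ_ _≈_

  _≟ʷ_ : DecidableEquality (Word G)
  _≟ʷ_ = ListP.≡-dec Fin._≟_

  indicator : Word G → Word G → ℚ
  indicator mon w with w ≟ʷ mon
  ... | yes _ = 1ℚ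
  ... | no _ = 0ℚ

  indicator-self : ∀ w → indicator w w ≡ 1ℚ
  indicator-self w with w ≟ʷ w
  ... | yes _ = refl
  ... | no w≢w = ⊥-elim (w≢w refl)

  indicator-≢ : ∀ mon w → w ≢ mon → indicator mon w ≡ 0ℚ
  indicator-≢ mon w w≢mon with w ≟ʷ mon
  ... | yes w≡mon = ⊥-elim (w≢mon w≡mon)
  ... | no _ = refl

  evalNF : (Word G → ℚ) → Maybe (ℚ × Word G) → ℚ
  evalNF f nothing = 0ℚ
  evalNF f (just (s , w)) = s * f w

  evaluate : (Word G → ℚ) → Combo G → ℚ
  evaluate f [] = 0ℚ
  evaluate f ((c , w) ∷ p) = c * evalNF f (normalize G w) + evaluate f p

  coeff≡evaluate : ∀ p mon → coeff G p mon ≡ evaluate (indicator mon) p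
  coeff≡evaluate [] mon = refl
  coeff≡evaluate ((c , w) ∷ p) mon with normalize G w
  ... | nothing = trans (coeff≡evaluate p mon)
                        (sym (trans (cong (_+ evaluate (indicator mon) p) (ℚP.*-zeroʳ c)) (ℚP.+-identityˡ _)))
  ... | just (s , w′) with w′ ≟ʷ mon
  ...   | yes _ = cong₂ _+_ (trans (sym (ℚP.*-identityʳ (c * s))) (ℚP.*-assoc c s 1ℚ)) (coeff≡evaluate p mon)
  ...   | no _ = trans (coeff≡evaluate p mon)
                       (sym (trans (cong (λ x → c * x + evaluate (indicator mon) p) (ℚP.*-zeroʳ s))
                                   (trans (cong (_+ evaluate (indicator mon) p) (ℚP.*-zeroʳ c)) (ℚP.+-identityˡ _))))

  Σterms : (Word G → ℚ) → Combo G → ℚ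
  Σterms f [] = 0ℚ
  Σterms f ((c , w) ∷ R) = c * f w + Σterms f R

  normalTerms : Combo G → Combo G
  normalTerms [] = []
  normalTerms ((c , w) ∷ p) with normalize G w
  ... | nothing = normalTerms p
  ... | just (s , w′) = (c * s , w′) ∷ normalTerms p

  evaluate≡Σterms : ∀ f p → evaluate f p ≡ Σterms f (normalTerms p)
  evaluate≡Σterms f [] = refl
  evaluate≡Σterms f ((c , w) ∷ p) with normalize G w
  ... | nothing = trans (cong (_+ evaluate f p) (ℚP.*-zeroʳ c)) (trans (ℚP.+-identityˡ _) (evaluate≡Σterms f p))
  ... | just (s , w′) = cong₂ _+_ (sym (ℚP.*-assoc c s (f w′))) (evaluate≡Σterms f p)

  Σterms-++ : ∀ f A B → Σterms f (A ++ B) ≡ Σterms f A + Σterms f B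
  Σterms-++ f [] B = sym (ℚP.+-identityˡ _)
  Σterms-++ f ((c , w) ∷ A) B = trans (cong (c * f w +_) (Σterms-++ f A B)) (sym (ℚP.+-assoc (c * f w) (Σterms f A) (Σterms f B)))

  negateTerms : Combo G → Combo G
  negateTerms = map (λ { (c , w) → (- c , w) })

  Σterms-negate : ∀ f A → Σterms f (negateTerms A) ≡ - Σterms f A
  Σterms-negate f [] = refl
  Σterms-negate f ((c , w) ∷ A) = trans (cong ((- c) * f w +_) (Σterms-negate f A))
    (solve 3 (λ c x y → (:- c) :* x :+ (:- y) := :- (c :* x :+ y)) refl c (f w) (Σterms f A))

  at? : (w₀ : Word G) → Decidable (λ (t : ℚ × Word G) → proj₂ t ≡ w₀)
  at? w₀ t = proj₂ t ≟ʷ w₀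

  off? : (w₀ : Word G) → Decidable (λ (t : ℚ × Word G) → proj₂ t ≢ w₀)
  off? w₀ t = ¬? (proj₂ t ≟ʷ w₀)

  Σcoeffs : Combo G → ℚ
  Σcoeffs [] = 0ℚ
  Σcoeffs ((c , w) ∷ R) = c + Σcoeffs R

  Σterms-split : ∀ f w₀ R → Σterms f R ≡ Σcoeffs (filter (at? w₀) R) * f w₀ + Σterms f (filter (off? w₀) R)
  Σterms-split f w₀ [] = sym (trans (cong (_+ 0ℚ) (ℚP.*-zeroˡ (f w₀))) (ℚP.+-identityˡ 0ℚ))
  Σterms-split f w₀ ((c , w) ∷ R) with w ≟ʷ w₀
  ... | yes refl = trans (cong (c * f w +_) (Σterms-split f w₀ R))
    (solve 4 (λ c C x y → c :* x :+ (C :* x :+ y) := (c :+ C) :* x :+ y) refl c (Σcoeffs (filter (at? w₀) R)) (f w) _)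
  ... | no _ = trans (cong (c * f w +_) (Σterms-split f w₀ R))
    (solve 3 (λ a x y → a :+ (x :+ y) := x :+ (a :+ y)) refl (c * f w) (Σcoeffs (filter (at? w₀) R) * f w₀) (Σterms f (filter (off? w₀) R)))

  Σterms-off-indicator : ∀ w₀ R → Σterms (indicator w₀) (filter (off? w₀) R) ≡ 0ℚ
  Σterms-off-indicator w₀ [] = refl
  Σterms-off-indicator w₀ ((c , w) ∷ R) with w ≟ʷ w₀
  ... | yes _ = Σterms-off-indicator w₀ R
  ... | no w≢w₀ = trans (cong₂ _+_ (trans (cong (c *_) (indicator-≢ w₀ w w≢w₀)) (ℚP.*-zeroʳ c)) (Σterms-off-indicator w₀ R))
                        (ℚP.+-identityˡ 0ℚ)

  -- The terms at the first word have total coefficient 0; dropping them keeps all coefficients 0.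
  Σterms-vanish : ∀ k f R → List.length R ℕ.≤ k → (∀ mon → Σterms (indicator mon) R ≡ 0ℚ) → Σterms f R ≡ 0ℚ
  Σterms-vanish k f [] _ _ = refl
  Σterms-vanish (suc k) f ((c , w₀) ∷ R) (ℕ.s≤s |R|≤k) vanish = begin
    Σterms f ((c , w₀) ∷ R)      ≡⟨ split f ⟩
    C * f w₀ + Σterms f R′       ≡⟨ cong₂ (λ x y → x * f w₀ + y) C≡0 (Σterms-vanish k f R′ |R′|≤k R′-vanish) ⟩
    0ℚ * f w₀ + 0ℚ               ≡⟨ solve 1 (λ x → con 0ℚ :* x :+ con 0ℚ := con 0ℚ) refl (f w₀) ⟩
    0ℚ                           ∎
    where
    open ≡-Reasoning
    C = c + Σcoeffs (filter (at? w₀) R)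
    R′ = filter (off? w₀) R
    split : ∀ g → Σterms g ((c , w₀) ∷ R) ≡ C * g w₀ + Σterms g R′
    split g = trans (cong (c * g w₀ +_) (Σterms-split g w₀ R))
      (solve 4 (λ c C x y → c :* x :+ (C :* x :+ y) := (c :+ C) :* x :+ y) refl c (Σcoeffs (filter (at? w₀) R)) (g w₀) (Σterms g R′))
    C≡0 : C ≡ 0ℚ
    C≡0 = begin
      C                                          ≡⟨ sym (trans (cong (_+ 0ℚ) (ℚP.*-identityʳ C)) (ℚP.+-identityʳ C)) ⟩
      C * 1ℚ + 0ℚ                                ≡⟨ sym (cong₂ (λ x y → C * x + y) (indicator-self w₀) (Σterms-off-indicator w₀ R)) ⟩
      C * indicator w₀ w₀ + Σterms (indicator w₀) R′  ≡⟨ sym (split (indicator w₀)) ⟩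
      Σterms (indicator w₀) ((c , w₀) ∷ R)       ≡⟨ vanish w₀ ⟩
      0ℚ                                         ∎
    R′-vanish : ∀ mon → Σterms (indicator mon) R′ ≡ 0ℚ
    R′-vanish mon with w₀ ≟ʷ mon
    ... | yes refl = Σterms-off-indicator w₀ R
    ... | no w₀≢mon = begin
      Σterms (indicator mon) R′                      ≡⟨ sym (trans (cong (_+ Σterms (indicator mon) R′) (ℚP.*-zeroʳ C)) (ℚP.+-identityˡ _)) ⟩
      C * 0ℚ + Σterms (indicator mon) R′              ≡⟨ cong (λ x → C * x + Σterms (indicator mon) R′) (sym (indicator-≢ mon w₀ w₀≢mon)) ⟩
      C * indicator mon w₀ + Σterms (indicator mon) R′ ≡⟨ sym (split (indicator mon)) ⟩
      Σterms (indicator mon) ((c , w₀) ∷ R)          ≡⟨ vanish mon ⟩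
      0ℚ                                             ∎
    |R′|≤k : List.length R′ ℕ.≤ k
    |R′|≤k = ℕP.≤-trans (ListP.length-filter (off? w₀) R) |R|≤k

  record _≈_ (p q : Combo G) : Set where
    constructor coeffwise
    field coeff-≡ : ∀ mon → coeff G p mon ≡ coeff G q mon
  open _≈_ public

  evaluate-cong : ∀ f {p q} → p ≈ q → evaluate f p ≡ evaluate f q
  evaluate-cong f {p} {q} p≈q = begin
    evaluate f p                 ≡⟨ evaluate≡Σterms f p ⟩
    Σterms f A                   ≡⟨ solve 2 (λ x y → x := (x :- y) :+ y) refl (Σterms f A) (Σterms f B) ⟩
    Σterms f A - Σterms f B + Σterms f B  ≡⟨ cong (_+ Σterms f B) (trans (sym (Σterms-difference f)) difference-vanishes) ⟩
    0ℚ + Σterms f B              ≡⟨ ℚP.+-identityˡ _ ⟩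
    Σterms f B                   ≡⟨ sym (evaluate≡Σterms f q) ⟩
    evaluate f q                 ∎
    where
    open ≡-Reasoning
    A = normalTerms p
    B = normalTerms q
    Σterms-difference : ∀ g → Σterms g (A ++ negateTerms B) ≡ Σterms g A - Σterms g B
    Σterms-difference g = trans (Σterms-++ g A (negateTerms B)) (cong (Σterms g A +_) (Σterms-negate g B))
    indicator-difference : ∀ mon → Σterms (indicator mon) (A ++ negateTerms B) ≡ 0ℚ
    indicator-difference mon = begin
      Σterms (indicator mon) (A ++ negateTerms B)        ≡⟨ Σterms-difference (indicator mon) ⟩
      Σterms (indicator mon) A - Σterms (indicator mon) B ≡⟨ cong₂ _-_ (sym (evaluate≡Σterms (indicator mon) p)) (sym (evaluate≡Σterms (indicator mon) q)) ⟩
      evaluate (indicator mon) p - evaluate (indicator mon) q ≡⟨ cong₂ _-_ (sym (coeff≡evaluate p mon)) (sym (coeff≡evaluate q mon)) ⟩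
      coeff G p mon - coeff G q mon                        ≡⟨ cong (_- coeff G q mon) (coeff-≡ p≈q mon) ⟩
      coeff G q mon - coeff G q mon                        ≡⟨ ℚP.+-inverseʳ (coeff G q mon) ⟩
      0ℚ                                                   ∎
    difference-vanishes : Σterms f (A ++ negateTerms B) ≡ 0ℚ
    difference-vanishes = Σterms-vanish _ f (A ++ negateTerms B) ℕP.≤-refl indicator-difference

  evaluate-++ : ∀ f p q → evaluate f (p ++ q) ≡ evaluate f p + evaluate f q
  evaluate-++ f [] q = sym (ℚP.+-identityˡ _)
  evaluate-++ f ((c , w) ∷ p) q = trans (cong (c * evalNF f (normalize G w) +_) (evaluate-++ f p q))
                                        (sym (ℚP.+-assoc (c * evalNF f (normalize G w)) (evaluate f p) (evaluate f q)))

  evaluate-scale : ∀ f a p → evaluate f (scale G a p) ≡ a * evaluate f p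
  evaluate-scale f a [] = sym (ℚP.*-zeroʳ a)
  evaluate-scale f a ((c , w) ∷ p) = trans (cong₂ _+_ (ℚP.*-assoc a c (evalNF f (normalize G w))) (evaluate-scale f a p))
                                           (sym (ℚP.*-distribˡ-+ a _ _))

  coeff-++ : ∀ p q mon → coeff G (p ++ q) mon ≡ coeff G p mon + coeff G q mon
  coeff-++ p q mon = trans (coeff≡evaluate (p ++ q) mon)
    (trans (evaluate-++ (indicator mon) p q) (sym (cong₂ _+_ (coeff≡evaluate p mon) (coeff≡evaluate q mon))))

  coeff-scale : ∀ a p mon → coeff G (scale G a p) mon ≡ a * coeff G p mon
  coeff-scale a p mon = trans (coeff≡evaluate (scale G a p) mon)
    (trans (evaluate-scale (indicator mon) a p) (cong (a *_) (sym (coeff≡evaluate p mon))))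

  ≈-refl : ∀ {p} → p ≈ p
  ≈-refl = coeffwise (λ mon → refl)

  ≈-reflexive : ∀ {p q} → p ≡ q → p ≈ q
  ≈-reflexive refl = ≈-refl

  ≈-sym : ∀ {p q} → p ≈ q → q ≈ p
  ≈-sym p≈q = coeffwise (λ mon → sym (coeff-≡ p≈q mon))

  ≈-trans : ∀ {p q r} → p ≈ q → q ≈ r → p ≈ r
  ≈-trans p≈q q≈r = coeffwise (λ mon → trans (coeff-≡ p≈q mon) (coeff-≡ q≈r mon))

  ≈-setoid : Setoid 0ℓ 0ℓ
  ≈-setoid = record
    { Carrier = Combo G
    ; _≈_ = _≈_
    ; isEquivalence = record { refl = ≈-refl ; sym = ≈-sym ; trans = ≈-trans }
    }

  module ≈-Reasoning = SetoidReasoning ≈-setoid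

  ++-cong : ∀ {p p′ q q′} → p ≈ p′ → q ≈ q′ → p ++ q ≈ p′ ++ q′
  ++-cong {p} {p′} {q} {q′} p≈p′ q≈q′ = coeffwise λ mon →
    trans (coeff-++ p q mon) (trans (cong₂ _+_ (coeff-≡ p≈p′ mon) (coeff-≡ q≈q′ mon)) (sym (coeff-++ p′ q′ mon)))

  ++-congˡ : ∀ p {q q′} → q ≈ q′ → p ++ q ≈ p ++ q′
  ++-congˡ p = ++-cong (≈-refl {p})

  ++-congʳ : ∀ {p p′} q → p ≈ p′ → p ++ q ≈ p′ ++ q
  ++-congʳ q p≈p′ = ++-cong p≈p′ (≈-refl {q})

  scale-cong : ∀ a {p q} → p ≈ q → scale G a p ≈ scale G a q
  scale-cong a {p} {q} p≈q = coeffwise λ mon →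
    trans (coeff-scale a p mon) (trans (cong (a *_) (coeff-≡ p≈q mon)) (sym (coeff-scale a q mon)))

  ++-comm : ∀ p q → p ++ q ≈ q ++ p
  ++-comm p q = coeffwise λ mon →
    trans (coeff-++ p q mon) (trans (ℚP.+-comm (coeff G p mon) (coeff G q mon)) (sym (coeff-++ q p mon)))

  ++-identityʳ : ∀ p → p ++ [] ≈ p
  ++-identityʳ p = coeffwise λ mon → trans (coeff-++ p [] mon) (ℚP.+-identityʳ _)

  ++-swap : ∀ x y z → x ++ (y ++ z) ≈ y ++ (x ++ z)
  ++-swap x y z = coeffwise λ mon → begin
    coeff G (x ++ (y ++ z)) mon                      ≡⟨ trans (coeff-++ x (y ++ z) mon) (cong (coeff G x mon +_) (coeff-++ y z mon)) ⟩
    coeff G x mon + (coeff G y mon + coeff G z mon)  ≡⟨ solve 3 (λ a b c → a :+ (b :+ c) := b :+ (a :+ c)) refl (coeff G x mon) (coeff G y mon) (coeff G z mon) ⟩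
    coeff G y mon + (coeff G x mon + coeff G z mon)  ≡⟨ sym (trans (coeff-++ y (x ++ z) mon) (cong (coeff G y mon +_) (coeff-++ x z mon))) ⟩
    coeff G (y ++ (x ++ z)) mon                      ∎
    where open ≡-Reasoning

  ++-interchange : ∀ A B C D → (A ++ B) ++ (C ++ D) ≈ (A ++ C) ++ (B ++ D)
  ++-interchange A B C D = coeffwise λ mon →
    let c = λ X → coeff G X mon
        expand : ∀ X Y Z W → c ((X ++ Y) ++ (Z ++ W)) ≡ (c X + c Y) + (c Z + c W)
        expand X Y Z W = trans (coeff-++ (X ++ Y) (Z ++ W) mon) (cong₂ _+_ (coeff-++ X Y mon) (coeff-++ Z W mon))
    in trans (expand A B C D)
      (trans (solve 4 (λ a b c d → (a :+ b) :+ (c :+ d) := (a :+ c) :+ (b :+ d)) refl (c A) (c B) (c C) (c D))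
             (sym (expand A C B D)))

  scale-++ : ∀ a p q → scale G a (p ++ q) ≈ scale G a p ++ scale G a q
  scale-++ a p q = ≈-reflexive (ListP.map-++ _ p q)

  scale-scale : ∀ a b p → scale G a (scale G b p) ≈ scale G (a * b) p
  scale-scale a b p = coeffwise λ mon →
    trans (coeff-scale a (scale G b p) mon)
      (trans (cong (a *_) (coeff-scale b p mon)) (trans (sym (ℚP.*-assoc a b (coeff G p mon))) (sym (coeff-scale (a * b) p mon))))

  scale-identity : ∀ p → scale G 1ℚ p ≈ p
  scale-identity p = coeffwise λ mon → trans (coeff-scale 1ℚ p mon) (ℚP.*-identityˡ _)

  scale-zero : ∀ p → scale G 0ℚ p ≈ []
  scale-zero p = coeffwise λ mon → trans (coeff-scale 0ℚ p mon) (ℚP.*-zeroˡ (coeff G p mon))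

  scale-≈[] : ∀ a {p} → p ≈ [] → scale G a p ≈ []
  scale-≈[] a {p} p≈[] = coeffwise λ mon → trans (coeff-scale a p mon) (trans (cong (a *_) (coeff-≡ p≈[] mon)) (ℚP.*-zeroʳ a))

  scale-+ : ∀ a b p → scale G a p ++ scale G b p ≈ scale G (a + b) p
  scale-+ a b p = coeffwise λ mon →
    trans (coeff-++ (scale G a p) (scale G b p) mon)
      (trans (cong₂ _+_ (coeff-scale a p mon) (coeff-scale b p mon))
             (trans (sym (ℚP.*-distribʳ-+ _ a b)) (sym (coeff-scale (a + b) p mon))))

  ++-inverseʳ : ∀ p → p ++ scale G (- 1ℚ) p ≈ []
  ++-inverseʳ p = coeffwise λ mon →
    trans (coeff-++ p _ mon) (trans (cong (coeff G p mon +_) (coeff-scale (- 1ℚ) p mon))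
      (solve 1 (λ x → x :+ (:- con 1ℚ) :* x := con 0ℚ) refl (coeff G p mon)))

  AllWords : (Word G → Set) → Combo G → Set
  AllWords Q p = All (λ t → Q (proj₂ t)) p

  AllWords-++ : ∀ {Q} p q → AllWords Q p → AllWords Q q → AllWords Q (p ++ q)
  AllWords-++ p q Qp Qq = AllP.++⁺ Qp Qq

  AllWords-scale : ∀ {Q} a p → AllWords Q p → AllWords Q (scale G a p)
  AllWords-scale a [] _ = []
  AllWords-scale a ((c , w) ∷ p) (Qw ∷ Qp) = Qw ∷ AllWords-scale a p Qp

  extend : (Word G → Combo G) → Combo G → Combo G
  extend T [] = []
  extend T ((c , w) ∷ p) = scale G c (T w) ++ extend T p

  extend-++ : ∀ T p q → extend T (p ++ q) ≡ extend T p ++ extend T q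
  extend-++ T [] q = refl
  extend-++ T ((c , w) ∷ p) q = trans (cong (scale G c (T w) ++_) (extend-++ T p q)) (sym (ListP.++-assoc (scale G c (T w)) (extend T p) (extend T q)))

  extend-scale : ∀ T a p → extend T (scale G a p) ≈ scale G a (extend T p)
  extend-scale T a [] = ≈-refl
  extend-scale T a ((c , w) ∷ p) =
    ≈-trans (++-cong (≈-sym (scale-scale a c (T w))) (extend-scale T a p)) (≈-sym (scale-++ a (scale G c (T w)) (extend T p)))

  extend-congˡ : ∀ {T T′} → (∀ w → T w ≈ T′ w) → ∀ p → extend T p ≈ extend T′ p
  extend-congˡ T≈T′ [] = ≈-refl
  extend-congˡ T≈T′ ((c , w) ∷ p) = ++-cong (scale-cong c (T≈T′ w)) (extend-congˡ T≈T′ p)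

  extend-congˡ-on : ∀ {Q : Word G → Set} {T T′} → (∀ w → Q w → T w ≈ T′ w) → ∀ p → AllWords Q p → extend T p ≈ extend T′ p
  extend-congˡ-on T≈T′ [] _ = ≈-refl
  extend-congˡ-on T≈T′ ((c , w) ∷ p) (Qw ∷ Qp) = ++-cong (scale-cong c (T≈T′ w Qw)) (extend-congˡ-on T≈T′ p Qp)

  extend-+ : ∀ T₁ T₂ p → extend T₁ p ++ extend T₂ p ≈ extend (λ w → T₁ w ++ T₂ w) p
  extend-+ T₁ T₂ [] = ≈-refl
  extend-+ T₁ T₂ ((c , w) ∷ p) =
    ≈-trans (++-interchange (scale G c (T₁ w)) (extend T₁ p) (scale G c (T₂ w)) (extend T₂ p))
            (++-cong (≈-sym (scale-++ c (T₁ w) (T₂ w))) (extend-+ T₁ T₂ p))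

  AllWords-extend : ∀ {Q₀ Q} T → (∀ w → Q₀ w → AllWords Q (T w)) → ∀ p → AllWords Q₀ p → AllWords Q (extend T p)
  AllWords-extend T QT [] _ = []
  AllWords-extend T QT ((c , w) ∷ p) (Q₀w ∷ Q₀p) =
    AllWords-++ (scale G c (T w)) (extend T p) (AllWords-scale c (T w) (QT w Q₀w)) (AllWords-extend T QT p Q₀p)

  RespectsNormalForm : (Word G → Combo G) → Set
  RespectsNormalForm T = ∀ w mon → coeff G (T w) mon ≡ evalNF (λ u → coeff G (T u) mon) (normalize G w)

  coeff-extend : ∀ T → RespectsNormalForm T → ∀ p mon → coeff G (extend T p) mon ≡ evaluate (λ u → coeff G (T u) mon) p
  coeff-extend T resp [] mon = refl
  coeff-extend T resp ((c , w) ∷ p) mon =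
    trans (coeff-++ (scale G c (T w)) (extend T p) mon)
          (cong₂ _+_ (trans (coeff-scale c (T w) mon) (cong (c *_) (resp w mon))) (coeff-extend T resp p mon))

  extend-congʳ : ∀ T → RespectsNormalForm T → ∀ {p q} → p ≈ q → extend T p ≈ extend T q
  extend-congʳ T resp {p} {q} p≈q = coeffwise λ mon →
    trans (coeff-extend T resp p mon) (trans (evaluate-cong (λ u → coeff G (T u) mon) p≈q) (sym (coeff-extend T resp q mon)))

  koszul : Gen G → Gen G → ℚ
  koszul g h = sgn (deg G g ℕ.* deg G h)

  koszul-sym : ∀ g h → koszul g h ≡ koszul h g
  koszul-sym g h = cong sgn (ℕP.*-comm (deg G g) (deg G h))

  koszul-sq : ∀ g h → koszul g h * koszul g h ≡ 1ℚ
  koszul-sq g h = sgn-sq (deg G g ℕ.* deg G h)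

  koszul-even : ∀ g → isOdd (deg G g) ≡ false → koszul g g ≡ 1ℚ
  koszul-even g even = sgn-even (deg G g ℕ.* deg G g) (trans (isOdd-* (deg G g) (deg G g)) (cong (λ b → b ∧ b) even))

  koszul-odd : ∀ g → isOdd (deg G g) ≡ true → koszul g g ≡ - 1ℚ
  koszul-odd g odd rewrite isOdd-* (deg G g) (deg G g) | odd = refl

  koszul-swap : ∀ g h x → x ≡ koszul g h * (1ℚ * (koszul h g * x))
  koszul-swap g h x = begin
    x                                       ≡⟨ sym (ℚP.*-identityˡ x) ⟩
    1ℚ * x                                  ≡⟨ cong (_* x) (sym (koszul-sq g h)) ⟩
    koszul g h * koszul g h * x             ≡⟨ solve 2 (λ s x → s :* s :* x := s :* (con 1ℚ :* (s :* x))) refl (koszul g h) x ⟩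
    koszul g h * (1ℚ * (koszul g h * x))    ≡⟨ cong (λ y → koszul g h * (1ℚ * (y * x))) (koszul-sym g h) ⟩
    koszul g h * (1ℚ * (koszul h g * x))    ∎
    where open ≡-Reasoning

  scaleNF : ℚ → Maybe (ℚ × Word G) → Maybe (ℚ × Word G)
  scaleNF s nothing = nothing
  scaleNF s (just (s′ , w)) = just (s * s′ , w)

  consNF : ℚ → Gen G → Maybe (ℚ × Word G) → Maybe (ℚ × Word G)
  consNF a h nothing = nothing
  consNF a h (just (s , t)) = just (a * s , h ∷ t)

  insertNF : Gen G → Maybe (ℚ × Word G) → Maybe (ℚ × Word G)
  insertNF g nothing = nothing
  insertNF g (just (s , w)) = scaleNF s (insertG G g w)

  normalize-∷ : ∀ g w → normalize G (g ∷ w) ≡ insertNF g (normalize G w)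
  normalize-∷ g w with normalize G w
  ... | nothing = refl
  ... | just (s , w′) with insertG G g w′
  ...   | nothing = refl
  ...   | just (s′ , w″) = refl

  insertG-< : ∀ {g h} t → g < h → insertG G g (h ∷ t) ≡ just (1ℚ , g ∷ h ∷ t)
  insertG-< {g} {h} t g<h with <-cmp g h
  ... | tri< _ _ _ = refl
  ... | tri≈ g≮h _ _ = ⊥-elim (g≮h g<h)
  ... | tri> g≮h _ _ = ⊥-elim (g≮h g<h)

  insertG-odd : ∀ {g} t → isOdd (deg G g) ≡ true → insertG G g (g ∷ t) ≡ nothing
  insertG-odd {g} t odd with <-cmp g g
  ... | tri< g<g _ _ = ⊥-elim (FinP.<-irrefl refl g<g)
  ... | tri> _ _ g>g = ⊥-elim (FinP.<-irrefl refl g>g)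
  ... | tri≈ _ _ _ rewrite odd = refl

  insertG-even : ∀ {g} t → isOdd (deg G g) ≡ false → insertG G g (g ∷ t) ≡ just (1ℚ , g ∷ g ∷ t)
  insertG-even {g} t even with <-cmp g g
  ... | tri< g<g _ _ = ⊥-elim (FinP.<-irrefl refl g<g)
  ... | tri> _ _ g>g = ⊥-elim (FinP.<-irrefl refl g>g)
  ... | tri≈ _ _ _ rewrite even = refl

  insertG-> : ∀ {g h} t → h < g → insertG G g (h ∷ t) ≡ consNF (koszul g h) h (insertG G g t)
  insertG-> {g} {h} t h<g with <-cmp g h
  ... | tri< g<h _ _ = ⊥-elim (FinP.<-asym g<h h<g)
  ... | tri≈ _ g≡h _ = ⊥-elim (FinP.<-irrefl (sym g≡h) h<g)
  ... | tri> _ _ _ with insertG G g t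
  ...   | nothing = refl
  ...   | just (s , t′) = refl

  data Proportional (r : ℚ) : Maybe (ℚ × Word G) → Maybe (ℚ × Word G) → Set where
    both-zero : Proportional r nothing nothing
    same-word : ∀ {a b w} → a ≡ r * b → Proportional r (just (a , w)) (just (b , w))

  Proportional-refl : ∀ X → Proportional 1ℚ X X
  Proportional-refl nothing = both-zero
  Proportional-refl (just (a , w)) = same-word (sym (ℚP.*-identityˡ a))

  Proportional-sym : ∀ {r X Y} → r * r ≡ 1ℚ → Proportional r X Y → Proportional r Y X
  Proportional-sym r²≡1 both-zero = both-zero
  Proportional-sym {r} r²≡1 (same-word {a} {b} a≡rb) = same-word (sym (begin
    r * a        ≡⟨ cong (r *_) a≡rb ⟩
    r * (r * b)  ≡⟨ sym (ℚP.*-assoc r r b) ⟩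
    r * r * b    ≡⟨ cong (_* b) r²≡1 ⟩
    1ℚ * b       ≡⟨ ℚP.*-identityˡ b ⟩
    b            ∎))
    where open ≡-Reasoning

  Proportional-trans : ∀ {r₁ r₂ X Y Z} → Proportional r₁ X Y → Proportional r₂ Y Z → Proportional (r₁ * r₂) X Z
  Proportional-trans both-zero both-zero = both-zero
  Proportional-trans {r₁} {r₂} (same-word a≡r₁b) (same-word {b = c} b≡r₂c) =
    same-word (trans a≡r₁b (trans (cong (r₁ *_) b≡r₂c) (sym (ℚP.*-assoc r₁ r₂ c))))

  Proportional-factor : ∀ {r r′ X Y} → r ≡ r′ → Proportional r X Y → Proportional r′ X Y
  Proportional-factor refl X∝Y = X∝Y

  Proportional⇒nothing : ∀ {r X} → Proportional r X nothing → X ≡ nothing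
  Proportional⇒nothing both-zero = refl

  consNF-proportional : ∀ {r X Y} a h → Proportional r X Y → Proportional r (consNF a h X) (consNF a h Y)
  consNF-proportional a h both-zero = both-zero
  consNF-proportional {r} a h (same-word {a = x} {b = y} x≡ry) =
    same-word (trans (cong (a *_) x≡ry) (solve 3 (λ a r y → a :* (r :* y) := r :* (a :* y)) refl a r y))

  scaleNF-proportional : ∀ {r X Y} a → Proportional r X Y → Proportional r (scaleNF a X) (scaleNF a Y)
  scaleNF-proportional a both-zero = both-zero
  scaleNF-proportional {r} a (same-word {a = x} {b = y} x≡ry) =
    same-word (trans (cong (a *_) x≡ry) (solve 3 (λ a r y → a :* (r :* y) := r :* (a :* y)) refl a r y))

  consNF-factor : ∀ {a a′} → a ≡ a′ → ∀ {k} X → Proportional 1ℚ (consNF a k X) (consNF a′ k X)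
  consNF-factor refl X = Proportional-refl _

  insertNF-consNF : ∀ g k a X → k < g →
    Proportional 1ℚ (insertNF g (consNF a k X)) (consNF (a * koszul g k) k (insertNF g X))
  insertNF-consNF g k a nothing k<g = both-zero
  insertNF-consNF g k a (just (s , t)) k<g rewrite insertG-> t k<g with insertG G g t
  ... | nothing = both-zero
  ... | just (s′ , t′) = same-word
    (solve 4 (λ a s x s′ → (a :* s) :* (x :* s′) := con 1ℚ :* ((a :* x) :* (s :* s′))) refl a s (koszul g k) s′)

  insertNF-twice-odd : ∀ g t → isOdd (deg G g) ≡ true → insertNF g (insertG G g t) ≡ nothing
  insertNF-twice-odd g [] odd rewrite insertG-odd {g} [] odd = refl
  insertNF-twice-odd g (k ∷ t) odd with order g k
  ... | less g<k rewrite insertG-< t g<k | insertG-odd {g} (k ∷ t) odd = refl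
  ... | equal refl rewrite insertG-odd {g} t odd = refl
  ... | greater k<g rewrite insertG-> {g} {k} t k<g =
    Proportional⇒nothing (subst (Proportional 1ℚ (insertNF g (consNF (koszul g k) k (insertG G g t))))
                                 (cong (consNF (koszul g k * koszul g k) k) (insertNF-twice-odd g t odd))
                                 (insertNF-consNF g k (koszul g k) (insertG G g t) k<g))

  InsertionsCommute : Gen G → Gen G → Word G → Set
  InsertionsCommute g h t = Proportional (koszul g h) (insertNF g (insertG G h t)) (insertNF h (insertG G g t))

  insertions-commute-front : ∀ {g h} t → g < h → insertG G h t ≡ just (1ℚ , h ∷ t) → insertG G g t ≡ just (1ℚ , g ∷ t) →
    InsertionsCommute g h t
  insertions-commute-front {g} {h} t g<h ins-h ins-g rewrite ins-h | ins-g | insertG-< t g<h | insertG-> t g<h | ins-h =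
    same-word (trans (ℚP.*-identityˡ 1ℚ) (koszul-swap g h 1ℚ))

  insertions-commute-between : ∀ {g h k} t → g < k → k < h → InsertionsCommute g h (k ∷ t)
  insertions-commute-between {g} {h} {k} t g<k k<h
    rewrite insertG-> t k<h | insertG-< t g<k | insertG-> (k ∷ t) (FinP.<-trans g<k k<h) | insertG-> t k<h
    with insertG G h t
  ... | nothing = both-zero
  ... | just (s , t′) rewrite insertG-< t′ g<k = same-word (trans (ℚP.*-identityʳ _) (koszul-swap g h (koszul h k * s)))

  insertions-commute-at-lower : ∀ {g h} t → g < h → InsertionsCommute g h (g ∷ t)
  insertions-commute-at-lower {g} {h} t g<h with isOdd (deg G g) in parity
  ... | true rewrite insertG-> t g<h | insertG-odd {g} t parity with insertG G h t
  ...   | nothing = both-zero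
  ...   | just (s , t′) rewrite insertG-odd {g} t′ parity = both-zero
  insertions-commute-at-lower {g} {h} t g<h | false
    rewrite insertG-> t g<h | insertG-even {g} t parity | insertG-> (g ∷ t) g<h | insertG-> t g<h with insertG G h t
  ... | nothing = both-zero
  ... | just (s , t′) rewrite insertG-even {g} t′ parity = same-word (trans (ℚP.*-identityʳ _) (koszul-swap g h (koszul h g * s)))

  insertions-commute-< : ∀ {g h} t → g < h → InsertionsCommute g h t
  insertions-commute-< [] g<h = insertions-commute-front [] g<h refl refl
  insertions-commute-< {g} {h} (k ∷ t) g<h with order h k
  ... | less h<k = insertions-commute-front (k ∷ t) g<h (insertG-< t h<k) (insertG-< t (FinP.<-trans g<h h<k))
  ... | equal refl with isOdd (deg G h) in parity
  ...   | true rewrite insertG-odd {h} t parity | insertG-< t g<h | insertG-> (h ∷ t) g<h | insertG-odd {h} t parity = both-zero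
  ...   | false = insertions-commute-front (h ∷ t) g<h (insertG-even t parity) (insertG-< t g<h)
  insertions-commute-< {g} {h} (k ∷ t) g<h | greater k<h with order g k
  ... | less g<k = insertions-commute-between t g<k k<h
  ... | equal refl = insertions-commute-at-lower t g<h
  ... | greater k<g rewrite insertG-> t k<h | insertG-> t k<g =
    Proportional-factor (solve 1 (λ x → con 1ℚ :* (x :* (con 1ℚ :* con 1ℚ)) := x) refl (koszul g h))
      (Proportional-trans (insertNF-consNF g k (koszul h k) (insertG G h t) k<g)
      (Proportional-trans (consNF-proportional (koszul h k * koszul g k) k (insertions-commute-< t g<h))
      (Proportional-trans (Proportional-factor (ℚP.*-identityˡ 1ℚ)
                            (Proportional-trans (consNF-factor (ℚP.*-comm (koszul h k) (koszul g k)) (insertNF h (insertG G g t)))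
                                                (Proportional-sym (ℚP.*-identityˡ 1ℚ) (insertNF-consNF h k (koszul g k) (insertG G g t) k<h))))
                          (Proportional-refl _))))

  insertions-commute : ∀ g h t → InsertionsCommute g h t
  insertions-commute g h t with order g h
  ... | less g<h = insertions-commute-< t g<h
  ... | greater h<g = Proportional-factor (koszul-sym h g) (Proportional-sym (koszul-sq h g) (insertions-commute-< t h<g))
  ... | equal refl with isOdd (deg G g) in parity
  ...   | true rewrite insertNF-twice-odd g t parity = both-zero
  ...   | false = Proportional-factor (sym (koszul-even g parity)) (Proportional-refl _)

  data Precedes (h : Gen G) : Word G → Set where
    precedes-[] : Precedes h []
    precedes-< : ∀ {k t} → h < k → Precedes h (k ∷ t)
    precedes-even : ∀ {t} → isOdd (deg G h) ≡ false → Precedes h (h ∷ t)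

  data Canonical : Word G → Set where
    canonical-[] : Canonical []
    canonical-∷ : ∀ {g t} → Precedes g t → Canonical t → Canonical (g ∷ t)

  CanonicalNF : Maybe (ℚ × Word G) → Set
  CanonicalNF nothing = ⊤
  CanonicalNF (just (_ , w)) = Canonical w

  PrecedesNF : Gen G → Maybe (ℚ × Word G) → Set
  PrecedesNF h nothing = ⊤
  PrecedesNF h (just (_ , w)) = Precedes h w

  consNF-precedes : ∀ {h k t} a X → Precedes h (k ∷ t) → PrecedesNF h (consNF a k X)
  consNF-precedes a nothing h-precedes = tt
  consNF-precedes a (just (s , w)) (precedes-< h<k) = precedes-< h<k
  consNF-precedes a (just (s , w)) (precedes-even even) = precedes-even even

  insertG-precedes : ∀ {h g} t → Precedes h t → h < g → PrecedesNF h (insertG G g t)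
  insertG-precedes [] h-precedes h<g = precedes-< h<g
  insertG-precedes {h} {g} (k ∷ t) h-precedes h<g with order g k
  ... | less g<k rewrite insertG-< t g<k = precedes-< h<g
  ... | equal refl with isOdd (deg G g) in parity
  ...   | true rewrite insertG-odd {g} t parity = tt
  ...   | false rewrite insertG-even {g} t parity = precedes-< h<g
  insertG-precedes {h} {g} (k ∷ t) h-precedes h<g | greater k<g rewrite insertG-> t k<g =
    consNF-precedes (koszul g k) (insertG G g t) h-precedes

  insertG-canonical : ∀ g t → Canonical t → CanonicalNF (insertG G g t)
  insertG-canonical g [] t-canonical = canonical-∷ precedes-[] canonical-[]
  insertG-canonical g (k ∷ t) (canonical-∷ k-precedes t-canonical) with order g k
  ... | less g<k rewrite insertG-< t g<k = canonical-∷ (precedes-< g<k) (canonical-∷ k-precedes t-canonical)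
  ... | equal refl with isOdd (deg G g) in parity
  ...   | true rewrite insertG-odd {g} t parity = tt
  ...   | false rewrite insertG-even {g} t parity = canonical-∷ (precedes-even parity) (canonical-∷ k-precedes t-canonical)
  insertG-canonical g (k ∷ t) (canonical-∷ k-precedes t-canonical) | greater k<g rewrite insertG-> t k<g
    with insertG G g t | insertG-canonical g t t-canonical | insertG-precedes {k} {g} t k-precedes k<g
  ... | nothing | _ | _ = tt
  ... | just (s , w) | w-canonical | k-precedes-w = canonical-∷ k-precedes-w w-canonical

  scaleNF-canonical : ∀ s X → CanonicalNF X → CanonicalNF (scaleNF s X)
  scaleNF-canonical s nothing _ = tt
  scaleNF-canonical s (just _) X-canonical = X-canonical

  normalize-canonical : ∀ w → CanonicalNF (normalize G w)
  normalize-canonical [] = canonical-[]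
  normalize-canonical (g ∷ w) rewrite normalize-∷ g w with normalize G w | normalize-canonical w
  ... | nothing | _ = tt
  ... | just (s , w′) | w′-canonical = scaleNF-canonical s (insertG G g w′) (insertG-canonical g w′ w′-canonical)

  normalize-fixes-canonical : ∀ w → Canonical w → normalize G w ≡ just (1ℚ , w)
  normalize-fixes-canonical [] _ = refl
  normalize-fixes-canonical (g ∷ t) (canonical-∷ precedes-[] t-canonical)
    rewrite normalize-∷ g t | normalize-fixes-canonical t t-canonical = refl
  normalize-fixes-canonical (g ∷ (k ∷ t)) (canonical-∷ (precedes-< g<k) t-canonical)
    rewrite normalize-∷ g (k ∷ t) | normalize-fixes-canonical (k ∷ t) t-canonical | insertG-< t g<k = refl
  normalize-fixes-canonical (g ∷ (g ∷ t)) (canonical-∷ (precedes-even even) t-canonical)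
    rewrite normalize-∷ g (g ∷ t) | normalize-fixes-canonical (g ∷ t) t-canonical | insertG-even {g} t even = refl

  normalize-idempotent : ∀ w {s w′} → normalize G w ≡ just (s , w′) → normalize G w′ ≡ just (1ℚ , w′)
  normalize-idempotent w {s} {w′} eq = normalize-fixes-canonical w′ (subst CanonicalNF eq (normalize-canonical w))

  normalTerms-canonical : ∀ p → AllWords Canonical (normalTerms p)
  normalTerms-canonical [] = []
  normalTerms-canonical ((c , w) ∷ p) with normalize G w | normalize-canonical w
  ... | nothing | _ = normalTerms-canonical p
  ... | just (s , w′) | w′-canonical = w′-canonical ∷ normalTerms-canonical p

  evaluate-canonical : ∀ f R → AllWords Canonical R → evaluate f R ≡ Σterms f R
  evaluate-canonical f [] _ = refl
  evaluate-canonical f ((c , w) ∷ R) (w-canonical ∷ R-canonical) rewrite normalize-fixes-canonical w w-canonical =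
    cong₂ _+_ (cong (c *_) (ℚP.*-identityˡ _)) (evaluate-canonical f R R-canonical)

  ≈-normalTerms : ∀ p → p ≈ normalTerms p
  ≈-normalTerms p = coeffwise λ mon → begin
    coeff G p mon                                    ≡⟨ coeff≡evaluate p mon ⟩
    evaluate (indicator mon) p                       ≡⟨ evaluate≡Σterms (indicator mon) p ⟩
    Σterms (indicator mon) (normalTerms p)           ≡⟨ evaluate-canonical (indicator mon) (normalTerms p) (normalTerms-canonical p) ⟨
    evaluate (indicator mon) (normalTerms p)         ≡⟨ coeff≡evaluate (normalTerms p) mon ⟨
    coeff G (normalTerms p) mon                      ∎
    where open ≡-Reasoning

  normalTerms-AllWords : ∀ {Q : Word G → Set} → (∀ w {s w′} → normalize G w ≡ just (s , w′) → Q w → Q w′) →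
    ∀ p → AllWords Q p → AllWords Q (normalTerms p)
  normalTerms-AllWords Q-stable [] _ = []
  normalTerms-AllWords Q-stable ((c , w) ∷ p) (Q-w ∷ Q-p) with normalize G w in w↦
  ... | nothing = normalTerms-AllWords Q-stable p Q-p
  ... | just (s , w′) = Q-stable w w↦ Q-w ∷ normalTerms-AllWords Q-stable p Q-p

  Σterms-∉ : ∀ mon R → mon ∉ map proj₂ R → Σterms (indicator mon) R ≡ 0ℚ
  Σterms-∉ mon [] _ = refl
  Σterms-∉ mon ((c , w) ∷ R) mon∉ =
    trans (cong₂ _+_ (trans (cong (c *_) (indicator-≢ mon w (λ eq → mon∉ (here (sym eq))))) (ℚP.*-zeroʳ c)) (Σterms-∉ mon R (λ m → mon∉ (there m))))
          (ℚP.+-identityˡ 0ℚ)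

  coeff-∉ : ∀ p mon → mon ∉ map proj₂ (normalTerms p) → coeff G p mon ≡ 0ℚ
  coeff-∉ p mon mon∉ = trans (coeff≡evaluate p mon) (trans (evaluate≡Σterms (indicator mon) p) (Σterms-∉ mon (normalTerms p) mon∉))

  evalNF-scaleNF : ∀ f s X → evalNF f (scaleNF s X) ≡ s * evalNF f X
  evalNF-scaleNF f s nothing = sym (ℚP.*-zeroʳ s)
  evalNF-scaleNF f s (just (s′ , w)) = ℚP.*-assoc s s′ (f w)

  evalNF-proportional : ∀ f {r X Y} → Proportional r X Y → evalNF f X ≡ r * evalNF f Y
  evalNF-proportional f {r} both-zero = sym (ℚP.*-zeroʳ r)
  evalNF-proportional f {r} (same-word {a} {b} {w} a≡rb) = trans (cong (_* f w) a≡rb) (ℚP.*-assoc r b (f w))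

  insertNF-scaleNF : ∀ g s X → Proportional 1ℚ (insertNF g (scaleNF s X)) (scaleNF s (insertNF g X))
  insertNF-scaleNF g s nothing = both-zero
  insertNF-scaleNF g s (just (s′ , w)) with insertG G g w
  ... | nothing = both-zero
  ... | just (s″ , v) = same-word (trans (ℚP.*-assoc s s′ s″) (sym (ℚP.*-identityˡ _)))

  insertNF-commute : ∀ g h X → Proportional (koszul g h) (insertNF g (insertNF h X)) (insertNF h (insertNF g X))
  insertNF-commute g h nothing = both-zero
  insertNF-commute g h (just (s , w)) =
    Proportional-factor (solve 1 (λ x → con 1ℚ :* (x :* con 1ℚ) := x) refl (koszul g h))
      (Proportional-trans (insertNF-scaleNF g s (insertG G h w))
      (Proportional-trans (scaleNF-proportional s (insertions-commute g h w))
                          (Proportional-sym (ℚP.*-identityˡ 1ℚ) (insertNF-scaleNF h s (insertG G g w)))))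

  monomial : ℚ → Word G → Combo G
  monomial c w = (c , w) ∷ []

  coeff-monomial : ∀ c w mon → coeff G (monomial c w) mon ≡ c * evalNF (indicator mon) (normalize G w)
  coeff-monomial c w mon = trans (coeff≡evaluate (monomial c w) mon) (ℚP.+-identityʳ _)

  monomial-proportional : ∀ {c c′ r w w′} → Proportional r (normalize G w) (normalize G w′) → c′ ≡ c * r →
    monomial c w ≈ monomial c′ w′
  monomial-proportional {c} {c′} {r} {w} {w′} w∝w′ c′≡cr = coeffwise λ mon → begin
    coeff G (monomial c w) mon                     ≡⟨ coeff-monomial c w mon ⟩
    c * evalNF (indicator mon) (normalize G w)     ≡⟨ cong (c *_) (evalNF-proportional (indicator mon) w∝w′) ⟩
    c * (r * evalNF (indicator mon) (normalize G w′)) ≡⟨ sym (ℚP.*-assoc c r _) ⟩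
    c * r * evalNF (indicator mon) (normalize G w′)   ≡⟨ cong (_* evalNF (indicator mon) (normalize G w′)) (sym c′≡cr) ⟩
    c′ * evalNF (indicator mon) (normalize G w′)   ≡⟨ sym (coeff-monomial c′ w′ mon) ⟩
    coeff G (monomial c′ w′) mon                   ∎
    where open ≡-Reasoning

  monomial-swap : ∀ g h b → monomial 1ℚ (g ∷ h ∷ b) ≈ monomial (koszul g h) (h ∷ g ∷ b)
  monomial-swap g h b = monomial-proportional g∷h∷b∝h∷g∷b (sym (ℚP.*-identityˡ _))
    where
    g∷h∷b∝h∷g∷b : Proportional (koszul g h) (normalize G (g ∷ h ∷ b)) (normalize G (h ∷ g ∷ b))
    g∷h∷b∝h∷g∷b rewrite normalize-∷ g (h ∷ b) | normalize-∷ h b | normalize-∷ h (g ∷ b) | normalize-∷ g b =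
      insertNF-commute g h (normalize G b)

  monomial-coeff : ∀ {c c′} w → c ≡ c′ → monomial c w ≈ monomial c′ w
  monomial-coeff w refl = ≈-refl

  monomial-zero : ∀ {c} w → c ≡ 0ℚ → monomial c w ≈ []
  monomial-zero {c} w refl = coeffwise λ mon → trans (coeff-monomial 0ℚ w mon) (ℚP.*-zeroˡ (evalNF (indicator mon) (normalize G w)))

  monomial-vanishing : ∀ c {w} → normalize G w ≡ nothing → monomial c w ≈ []
  monomial-vanishing c {w} w↦0 = coeffwise λ mon →
    trans (coeff-monomial c w mon) (trans (cong (λ X → c * evalNF (indicator mon) X) w↦0) (ℚP.*-zeroʳ c))

  monomial-+ : ∀ a b w → monomial (a + b) w ≈ monomial a w ++ monomial b w
  monomial-+ a b w = coeffwise λ mon →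
    trans (coeff-monomial (a + b) w mon)
      (trans (ℚP.*-distribʳ-+ _ a b)
             (sym (trans (coeff-++ (monomial a w) (monomial b w) mon) (cong₂ _+_ (coeff-monomial a w mon) (coeff-monomial b w mon)))))

  ∷-cong : ∀ {c c′ w w′ p q} → monomial c w ≈ monomial c′ w′ → p ≈ q → (c , w) ∷ p ≈ (c′ , w′) ∷ q
  ∷-cong = ++-cong

  extend-scaled-monomial : ∀ q p → extend (λ w → scale G q (monomial 1ℚ w)) p ≈ scale G q p
  extend-scaled-monomial q [] = ≈-refl
  extend-scaled-monomial q ((c , w) ∷ p) =
    ∷-cong (monomial-coeff w (solve 2 (λ c q → c :* (q :* con 1ℚ) := q :* c) refl c q)) (extend-scaled-monomial q p)

  lmul : ℚ → Gen G → Combo G → Combo G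
  lmul e g [] = []
  lmul e g ((c , v) ∷ p) = (e * c , g ∷ v) ∷ lmul e g p

  coeff-lmul : ∀ e g p mon → coeff G (lmul e g p) mon ≡ e * evaluate (λ u → evalNF (indicator mon) (normalize G (g ∷ u))) p
  coeff-lmul e g [] mon = sym (ℚP.*-zeroʳ e)
  coeff-lmul e g ((c , v) ∷ p) mon =
    trans (coeff≡evaluate (lmul e g ((c , v) ∷ p)) mon)
      (trans (cong₂ _+_ (trans (ℚP.*-assoc e c _) (cong (λ x → e * (c * x)) normalize-g∷v))
                        (trans (sym (coeff≡evaluate (lmul e g p) mon)) (coeff-lmul e g p mon)))
             (sym (ℚP.*-distribˡ-+ e _ _)))
    where
    F = λ u → evalNF (indicator mon) (normalize G (g ∷ u))
    normalize-g∷v : evalNF (indicator mon) (normalize G (g ∷ v)) ≡ evalNF F (normalize G v)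
    normalize-g∷v rewrite normalize-∷ g v with normalize G v in v↦
    ... | nothing = refl
    ... | just (s , v′) rewrite normalize-∷ g v′ | normalize-idempotent v v↦ =
      trans (evalNF-scaleNF (indicator mon) s (insertG G g v′))
            (cong (s *_) (sym (trans (evalNF-scaleNF (indicator mon) 1ℚ (insertG G g v′)) (ℚP.*-identityˡ _))))

  lmul-cong : ∀ e g {p q} → p ≈ q → lmul e g p ≈ lmul e g q
  lmul-cong e g {p} {q} p≈q = coeffwise λ mon →
    trans (coeff-lmul e g p mon) (trans (cong (e *_) (evaluate-cong _ p≈q)) (sym (coeff-lmul e g q mon)))

  lmul-++ : ∀ e g p q → lmul e g (p ++ q) ≡ lmul e g p ++ lmul e g q
  lmul-++ e g [] q = refl
  lmul-++ e g ((c , v) ∷ p) q = cong ((e * c , g ∷ v) ∷_) (lmul-++ e g p q)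

  lmul-scale : ∀ e g a p → lmul e g (scale G a p) ≈ scale G a (lmul e g p)
  lmul-scale e g a [] = ≈-refl
  lmul-scale e g a ((c , v) ∷ p) =
    ∷-cong (monomial-coeff (g ∷ v) (solve 3 (λ e a c → e :* (a :* c) := a :* (e :* c)) refl e a c)) (lmul-scale e g a p)

  lmul-factor : ∀ e g p → lmul e g p ≈ scale G e (lmul 1ℚ g p)
  lmul-factor e g [] = ≈-refl
  lmul-factor e g ((c , v) ∷ p) = ∷-cong (monomial-coeff (g ∷ v) (cong (e *_) (sym (ℚP.*-identityˡ c)))) (lmul-factor e g p)

  lmul-monomial : ∀ c x w → monomial c (x ∷ w) ≈ lmul 1ℚ x (monomial c w)
  lmul-monomial c x w = monomial-coeff (x ∷ w) (sym (ℚP.*-identityˡ c))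

  AllWords-lmul : ∀ {Q Q′} e g p → (∀ v → Q v → Q′ (g ∷ v)) → AllWords Q p → AllWords Q′ (lmul e g p)
  AllWords-lmul e g [] _ _ = []
  AllWords-lmul e g ((c , v) ∷ p) Q⇒Q′ (Qv ∷ Qp) = Q⇒Q′ v Qv ∷ AllWords-lmul e g p Q⇒Q′ Qp

  lmulʷ : Word G → Combo G → Combo G
  lmulʷ u = map (λ { (c , v) → (c , u ++ v) })

  lmulʷ-∷ : ∀ g u p → lmulʷ (g ∷ u) p ≈ lmul 1ℚ g (lmulʷ u p)
  lmulʷ-∷ g u [] = ≈-refl
  lmulʷ-∷ g u ((c , v) ∷ p) = ∷-cong (monomial-coeff (g ∷ u ++ v) (sym (ℚP.*-identityˡ c))) (lmulʷ-∷ g u p)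

  lmulʷ-[] : ∀ p → lmulʷ [] p ≡ p
  lmulʷ-[] p = trans (ListP.map-cong (λ { (c , v) → refl }) p) (ListP.map-id p)

  lmulʷ-cong : ∀ u {p q} → p ≈ q → lmulʷ u p ≈ lmulʷ u q
  lmulʷ-cong [] {p} {q} p≈q rewrite lmulʷ-[] p | lmulʷ-[] q = p≈q
  lmulʷ-cong (g ∷ u) {p} {q} p≈q =
    ≈-trans (lmulʷ-∷ g u p) (≈-trans (lmul-cong 1ℚ g (lmulʷ-cong u p≈q)) (≈-sym (lmulʷ-∷ g u q)))

  sgn-degW-∷ : ∀ h x a → sgn (deg G h ℕ.* degW G a) * koszul x h ≡ sgn (deg G h ℕ.* degW G (x ∷ a))
  sgn-degW-∷ h x a = sym (begin
    sgn (deg G h ℕ.* (deg G x ℕ.+ degW G a))            ≡⟨ cong sgn (trans (ℕP.*-distribˡ-+ (deg G h) (deg G x) (degW G a)) (ℕP.+-comm (deg G h ℕ.* deg G x) _)) ⟩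
    sgn (deg G h ℕ.* degW G a ℕ.+ deg G h ℕ.* deg G x)   ≡⟨ sgn-+ (deg G h ℕ.* degW G a) (deg G h ℕ.* deg G x) ⟩
    sgn (deg G h ℕ.* degW G a) * koszul h x              ≡⟨ cong (sgn (deg G h ℕ.* degW G a) *_) (koszul-sym h x) ⟩
    sgn (deg G h ℕ.* degW G a) * koszul x h              ∎)
    where open ≡-Reasoning

  monomial-move : ∀ a h b → monomial 1ℚ (a ++ h ∷ b) ≈ monomial (sgn (deg G h ℕ.* degW G a)) (h ∷ a ++ b)
  monomial-move [] h b rewrite ℕP.*-zeroʳ (deg G h) = ≈-refl
  monomial-move (x ∷ a) h b = begin
    monomial 1ℚ (x ∷ a ++ h ∷ b)               ≈⟨ lmul-monomial 1ℚ x (a ++ h ∷ b) ⟩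
    lmul 1ℚ x (monomial 1ℚ (a ++ h ∷ b))       ≈⟨ lmul-cong 1ℚ x (monomial-move a h b) ⟩
    lmul 1ℚ x (monomial ε (h ∷ a ++ b))        ≈⟨ monomial-coeff (x ∷ h ∷ a ++ b) (trans (ℚP.*-identityˡ ε) (sym (ℚP.*-identityʳ ε))) ⟩
    scale G ε (monomial 1ℚ (x ∷ h ∷ a ++ b))   ≈⟨ scale-cong ε (monomial-swap x h (a ++ b)) ⟩
    monomial (ε * koszul x h) (h ∷ x ∷ a ++ b) ≈⟨ monomial-coeff (h ∷ x ∷ a ++ b) (sgn-degW-∷ h x a) ⟩
    monomial (sgn (deg G h ℕ.* degW G (x ∷ a))) (h ∷ x ∷ a ++ b) ∎
    where
    open ≈-Reasoning
    ε = sgn (deg G h ℕ.* degW G a)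

  weight : (Gen G → ℕ) → Word G → ℕ
  weight f [] = 0
  weight f (g ∷ w) = f g ℕ.+ weight f w

  weight-++ : ∀ f u v → weight f (u ++ v) ≡ weight f u ℕ.+ weight f v
  weight-++ f [] v = refl
  weight-++ f (x ∷ u) v = trans (cong (f x ℕ.+_) (weight-++ f u v)) (sym (ℕP.+-assoc (f x) _ _))

  degW≡weight : ∀ w → degW G w ≡ weight (deg G) w
  degW≡weight [] = refl
  degW≡weight (g ∷ w) = cong (deg G g ℕ.+_) (degW≡weight w)

  HasWeightNF : (Gen G → ℕ) → ℕ → Maybe (ℚ × Word G) → Set
  HasWeightNF f k nothing = ⊤
  HasWeightNF f k (just (_ , w)) = weight f w ≡ k

  consNF-weight : ∀ f {k h} a X → HasWeightNF f k X → HasWeightNF f (f h ℕ.+ k) (consNF a h X)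
  consNF-weight f a nothing _ = tt
  consNF-weight f a (just _) X-weight = cong (_ ℕ.+_) X-weight

  insertG-weight : ∀ f g t → HasWeightNF f (f g ℕ.+ weight f t) (insertG G g t)
  insertG-weight f g [] = refl
  insertG-weight f g (k ∷ t) with order g k
  ... | less g<k rewrite insertG-< t g<k = refl
  ... | equal refl with isOdd (deg G g) in parity
  ...   | true rewrite insertG-odd {g} t parity = tt
  ...   | false rewrite insertG-even {g} t parity = refl
  insertG-weight f g (k ∷ t) | greater k<g rewrite insertG-> t k<g =
    subst (λ x → HasWeightNF f x (consNF (koszul g k) k (insertG G g t)))
          (ℕ+.x∙yz≈y∙xz (f k) (f g) (weight f t))
          (consNF-weight f (koszul g k) (insertG G g t) (insertG-weight f g t))

  normalize-weight : ∀ f w → HasWeightNF f (weight f w) (normalize G w)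
  normalize-weight f [] = refl
  normalize-weight f (g ∷ w) rewrite normalize-∷ g w with normalize G w | normalize-weight f w
  ... | nothing | _ = tt
  ... | just (s , w′) | w′-weight with insertG G g w′ | insertG-weight f g w′
  ...   | nothing | _ = tt
  ...   | just (s′ , w″) | w″-weight = trans w″-weight (cong (f g ℕ.+_) w′-weight)

  normalize-preserves-weight : ∀ f w {s w′} → normalize G w ≡ just (s , w′) → weight f w′ ≡ weight f w
  normalize-preserves-weight f w w↦ = subst (HasWeightNF f (weight f w)) w↦ (normalize-weight f w)

  sign : Gen G → ℚ
  sign g = sgn (deg G g)

  GeneratorMap : Set
  GeneratorMap = Gen G → Maybe (Word G)

  headTerm : Maybe (Word G) → Word G → Combo G
  headTerm nothing w = []
  headTerm (just u) w = monomial 1ℚ (u ++ w)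

  derive : GeneratorMap → Word G → Combo G
  derive δ [] = []
  derive δ (g ∷ w) = headTerm (δ g) w ++ lmul (sign g) g (derive δ w)

  D : GeneratorMap → Combo G → Combo G
  D δ = extend (derive δ)

  ReversesParityAt : Gen G → Maybe (Word G) → Set
  ReversesParityAt g nothing = ⊤
  ReversesParityAt g (just u) = isOdd (degW G u) ≡ not (isOdd (deg G g))

  ReversesParity : GeneratorMap → Set
  ReversesParity δ = ∀ g → ReversesParityAt g (δ g)

  headTerm-∷ : ∀ g h M t → ReversesParityAt g M → headTerm M (h ∷ t) ≈ scale G (koszul g h) (lmul (sign h) h (headTerm M t))
  headTerm-∷ g h nothing t _ = ≈-refl
  headTerm-∷ g h (just u) t u-parity =
    ≈-trans (monomial-move u h t)
            (monomial-coeff (h ∷ u ++ t) (trans (sgn-*-opposite-parity (deg G g) (deg G h) (degW G u) u-parity)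
                                               (cong (koszul g h *_) (sym (ℚP.*-identityʳ (sign h))))))

  lmul-swap : ∀ a b g h p → lmul a g (lmul b h p) ≈ scale G (koszul g h) (lmul b h (lmul a g p))
  lmul-swap a b g h [] = ≈-refl
  lmul-swap a b g h ((c , v) ∷ p) = ∷-cong
    (≈-trans (monomial-coeff (g ∷ h ∷ v) (sym (ℚP.*-identityʳ _)))
      (≈-trans (scale-cong (a * (b * c)) (monomial-swap g h v))
               (monomial-coeff (h ∷ g ∷ v) (solve 4 (λ a b c s → (a :* (b :* c)) :* s := s :* (b :* (a :* c))) refl a b c (koszul g h)))))
    (lmul-swap a b g h p)

  scale-koszul-cancel : ∀ g h p → scale G (koszul g h) (scale G (koszul h g) p) ≈ p
  scale-koszul-cancel g h p = begin
    scale G (koszul g h) (scale G (koszul h g) p)  ≈⟨ scale-scale (koszul g h) (koszul h g) p ⟩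
    scale G (koszul g h * koszul h g) p            ≡⟨ cong (λ x → scale G (koszul g h * x) p) (sym (koszul-sym g h)) ⟩
    scale G (koszul g h * koszul g h) p            ≡⟨ cong (λ x → scale G x p) (koszul-sq g h) ⟩
    scale G 1ℚ p                                   ≈⟨ scale-identity p ⟩
    p                                              ∎
    where open ≈-Reasoning

  derive-swap : ∀ δ → ReversesParity δ → ∀ g h t → derive δ (g ∷ h ∷ t) ≈ scale G (koszul g h) (derive δ (h ∷ g ∷ t))
  derive-swap δ δ-parity g h t = begin
    derive δ (g ∷ h ∷ t)                                     ≡⟨ cong (headTerm (δ g) (h ∷ t) ++_) (lmul-++ (sign g) g (headTerm (δ h) t) (lmul (sign h) h (derive δ t))) ⟩
    headTerm (δ g) (h ∷ t) ++ (lmul (sign g) g (headTerm (δ h) t) ++ lmul (sign g) g (lmul (sign h) h (derive δ t)))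
      ≈⟨ ++-cong A (++-cong B C) ⟩
    scale G κ B′ ++ (scale G κ A′ ++ scale G κ C′)            ≈⟨ ++-swap (scale G κ B′) (scale G κ A′) (scale G κ C′) ⟩
    scale G κ A′ ++ (scale G κ B′ ++ scale G κ C′)            ≈⟨ ++-congˡ (scale G κ A′) (scale-++ κ B′ C′) ⟨
    scale G κ A′ ++ scale G κ (B′ ++ C′)                      ≈⟨ scale-++ κ A′ (B′ ++ C′) ⟨
    scale G κ (A′ ++ (B′ ++ C′))                              ≡⟨ cong (λ x → scale G κ (A′ ++ x)) (sym (lmul-++ (sign h) h (headTerm (δ g) t) (lmul (sign g) g (derive δ t)))) ⟩
    scale G κ (derive δ (h ∷ g ∷ t))                          ∎
    where
    open ≈-Reasoning
    κ = koszul g h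
    A′ = headTerm (δ h) (g ∷ t)
    B′ = lmul (sign h) h (headTerm (δ g) t)
    C′ = lmul (sign h) h (lmul (sign g) g (derive δ t))
    A : headTerm (δ g) (h ∷ t) ≈ scale G κ B′
    A = headTerm-∷ g h (δ g) t (δ-parity g)
    B : lmul (sign g) g (headTerm (δ h) t) ≈ scale G κ A′
    B = ≈-sym (≈-trans (scale-cong κ (headTerm-∷ h g (δ h) t (δ-parity h))) (scale-koszul-cancel g h _))
    C : lmul (sign g) g (lmul (sign h) h (derive δ t)) ≈ scale G κ C′
    C = lmul-swap (sign g) (sign h) g h (derive δ t)

  normalize-odd-square : ∀ g v → isOdd (deg G g) ≡ true → normalize G (g ∷ g ∷ v) ≡ nothing
  normalize-odd-square g v odd rewrite normalize-∷ g (g ∷ v) | normalize-∷ g v with normalize G v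
  ... | nothing = refl
  ... | just (s , v′) = Proportional⇒nothing
    (subst (Proportional 1ℚ (insertNF g (scaleNF s (insertG G g v′)))) (cong (scaleNF s) (insertNF-twice-odd g v′ odd))
           (insertNF-scaleNF g s (insertG G g v′)))

  lmul-odd-square : ∀ g → isOdd (deg G g) ≡ true → ∀ a b p → lmul a g (lmul b g p) ≈ []
  lmul-odd-square g odd a b [] = ≈-refl
  lmul-odd-square g odd a b ((c , v) ∷ p) =
    ++-cong (monomial-vanishing (a * (b * c)) (normalize-odd-square g v odd)) (lmul-odd-square g odd a b p)

  derive-odd-square : ∀ δ → ReversesParity δ → ∀ g t → isOdd (deg G g) ≡ true → derive δ (g ∷ g ∷ t) ≈ []
  derive-odd-square δ δ-parity g t odd = begin
    derive δ (g ∷ g ∷ t)                                   ≡⟨ cong (headTerm (δ g) (g ∷ t) ++_) (lmul-++ (sign g) g (headTerm (δ g) t) (lmul (sign g) g (derive δ t))) ⟩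
    headTerm (δ g) (g ∷ t) ++ (B ++ lmul (sign g) g (lmul (sign g) g (derive δ t)))
      ≈⟨ ++-cong (headTerm-∷ g g (δ g) t (δ-parity g)) (++-congˡ B (lmul-odd-square g odd (sign g) (sign g) (derive δ t))) ⟩
    scale G (koszul g g) B ++ (B ++ [])                    ≡⟨ cong (λ x → scale G x B ++ (B ++ [])) (koszul-odd g odd) ⟩
    scale G (- 1ℚ) B ++ (B ++ [])                          ≈⟨ ++-congˡ (scale G (- 1ℚ) B) (++-identityʳ B) ⟩
    scale G (- 1ℚ) B ++ B                                  ≈⟨ ++-comm _ B ⟩
    B ++ scale G (- 1ℚ) B                                  ≈⟨ ++-inverseʳ B ⟩
    []                                                     ∎
    where
    open ≈-Reasoning
    B = lmul (sign g) g (headTerm (δ g) t)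

  FactorsThroughNF : (Word G → Combo G) → Word G → Maybe (ℚ × Word G) → Set
  FactorsThroughNF F w nothing = F w ≈ []
  FactorsThroughNF F w (just (s , w′)) = F w ≈ scale G s (F w′)

  monomial-normalize : ∀ w → FactorsThroughNF (monomial 1ℚ) w (normalize G w)
  monomial-normalize w with normalize G w in w↦
  ... | nothing = monomial-vanishing 1ℚ w↦
  ... | just (s , w′) = monomial-proportional {r = s}
    (subst₂ (Proportional s) (sym w↦) (sym (normalize-idempotent w w↦)) (same-word (sym (ℚP.*-identityʳ s))))
    (trans (ℚP.*-identityʳ s) (sym (ℚP.*-identityˡ s)))

  monomial-insertG : ∀ g t → Canonical t → FactorsThroughNF (monomial 1ℚ) (g ∷ t) (insertG G g t)
  monomial-insertG g t t-canonical =
    unscale (insertG G g t) (subst (FactorsThroughNF (monomial 1ℚ) (g ∷ t))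
                                   (trans (normalize-∷ g t) (cong (insertNF g) (normalize-fixes-canonical t t-canonical)))
                                   (monomial-normalize (g ∷ t)))
    where
    unscale : ∀ X → FactorsThroughNF (monomial 1ℚ) (g ∷ t) (scaleNF 1ℚ X) → FactorsThroughNF (monomial 1ℚ) (g ∷ t) X
    unscale nothing g∷t≈ = g∷t≈
    unscale (just (s , w′)) g∷t≈ = ≈-trans g∷t≈ (monomial-coeff w′ (cong (_* 1ℚ) (ℚP.*-identityˡ s)))

  headTerm-factors : ∀ M {v} X → FactorsThroughNF (monomial 1ℚ) v X → FactorsThroughNF (headTerm M) v X
  headTerm-factors nothing nothing _ = ≈-refl
  headTerm-factors nothing (just _) _ = ≈-refl
  headTerm-factors (just u) nothing v≈ = lmulʷ-cong u v≈
  headTerm-factors (just u) (just _) v≈ = lmulʷ-cong u v≈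

  derive-∷-factors : ∀ δ g {w} X → FactorsThroughNF (monomial 1ℚ) w X → FactorsThroughNF (derive δ) w X →
    FactorsThroughNF (λ v → derive δ (g ∷ v)) w X
  derive-∷-factors δ g nothing w≈ dw≈ = ++-cong (headTerm-factors (δ g) nothing w≈) (lmul-cong (sign g) g dw≈)
  derive-∷-factors δ g {w} (just (s , w′)) w≈ dw≈ = begin
    headTerm (δ g) w ++ lmul (sign g) g (derive δ w)
      ≈⟨ ++-cong (headTerm-factors (δ g) (just (s , w′)) w≈) (lmul-cong (sign g) g dw≈) ⟩
    scale G s (headTerm (δ g) w′) ++ lmul (sign g) g (scale G s (derive δ w′))
      ≈⟨ ++-congˡ (scale G s (headTerm (δ g) w′)) (lmul-scale (sign g) g s (derive δ w′)) ⟩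
    scale G s (headTerm (δ g) w′) ++ scale G s (lmul (sign g) g (derive δ w′))
      ≈⟨ scale-++ s (headTerm (δ g) w′) (lmul (sign g) g (derive δ w′)) ⟨
    scale G s (derive δ (g ∷ w′)) ∎
    where open ≈-Reasoning

  derive-insertG : ∀ δ → ReversesParity δ → ∀ g t → Canonical t → FactorsThroughNF (derive δ) (g ∷ t) (insertG G g t)
  derive-insertG δ δ-parity g [] _ = ≈-sym (scale-identity _)
  derive-insertG δ δ-parity g (k ∷ t) (canonical-∷ k-precedes t-canonical) with order g k
  ... | less g<k rewrite insertG-< t g<k = ≈-sym (scale-identity _)
  ... | equal refl with isOdd (deg G g) in parity
  ...   | true rewrite insertG-odd {g} t parity = derive-odd-square δ δ-parity g t parity
  ...   | false rewrite insertG-even {g} t parity = ≈-sym (scale-identity _)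
  derive-insertG δ δ-parity g (k ∷ t) (canonical-∷ k-precedes t-canonical) | greater k<g rewrite insertG-> t k<g
    with insertG G g t | derive-insertG δ δ-parity g t t-canonical | monomial-insertG g t t-canonical
  ... | nothing | dg∷t≈ | g∷t≈ =
    ≈-trans (derive-swap δ δ-parity g k t) (scale-≈[] (koszul g k) (derive-∷-factors δ k nothing g∷t≈ dg∷t≈))
  ... | just (s , w) | dg∷t≈ | g∷t≈ =
    ≈-trans (derive-swap δ δ-parity g k t)
      (≈-trans (scale-cong (koszul g k) (derive-∷-factors δ k (just (s , w)) g∷t≈ dg∷t≈)) (scale-scale (koszul g k) s (derive δ (k ∷ w))))

  derive-normalize : ∀ δ → ReversesParity δ → ∀ w → FactorsThroughNF (derive δ) w (normalize G w)
  derive-normalize δ δ-parity [] = ≈-sym (scale-identity [])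
  derive-normalize δ δ-parity (g ∷ w) rewrite normalize-∷ g w
    with normalize G w in w↦ | derive-normalize δ δ-parity w | monomial-normalize w
  ... | nothing | dw≈ | w≈ = derive-∷-factors δ g nothing w≈ dw≈
  ... | just (s , w′) | dw≈ | w≈ with insertG G g w′ | derive-insertG δ δ-parity g w′ (subst CanonicalNF w↦ (normalize-canonical w))
  ...   | nothing | dg∷w′≈ =
    ≈-trans (derive-∷-factors δ g (just (s , w′)) w≈ dw≈) (scale-≈[] s dg∷w′≈)
  ...   | just (s′ , w″) | dg∷w′≈ =
    ≈-trans (derive-∷-factors δ g (just (s , w′)) w≈ dw≈) (≈-trans (scale-cong s dg∷w′≈) (scale-scale s s′ (derive δ w″)))

  derive-respects-normal-form : ∀ δ → ReversesParity δ → RespectsNormalForm (derive δ)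
  derive-respects-normal-form δ δ-parity w mon with normalize G w | derive-normalize δ δ-parity w
  ... | nothing | dw≈[] = coeff-≡ dw≈[] mon
  ... | just (s , w′) | dw≈ = trans (coeff-≡ dw≈ mon) (coeff-scale s (derive δ w′) mon)

  D-cong : ∀ δ → ReversesParity δ → ∀ {p q} → p ≈ q → D δ p ≈ D δ q
  D-cong δ δ-parity = extend-congʳ (derive δ) (derive-respects-normal-form δ δ-parity)

  -- The Leibniz rule, anticommutators of derivations, and D² = 0

  rmulʷ : Combo G → Word G → Combo G
  rmulʷ p w = map (λ { (c , v) → (c , v ++ w) }) p

  rmulʷ-lmul : ∀ e g p w → rmulʷ (lmul e g p) w ≡ lmul e g (rmulʷ p w)
  rmulʷ-lmul e g [] w = refl
  rmulʷ-lmul e g ((c , v) ∷ p) w = cong ((e * c , g ∷ v ++ w) ∷_) (rmulʷ-lmul e g p w)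

  headTerm-++ : ∀ M a w → headTerm M (a ++ w) ≡ rmulʷ (headTerm M a) w
  headTerm-++ nothing a w = refl
  headTerm-++ (just u) a w = cong (λ z → monomial 1ℚ z) (sym (ListP.++-assoc u a w))

  lmulʷ-sign-∷ : ∀ x a P → lmul (sign x) x (scale G (sgn (degW G a)) (lmulʷ a P)) ≈ scale G (sgn (degW G (x ∷ a))) (lmulʷ (x ∷ a) P)
  lmulʷ-sign-∷ x a P = begin
    lmul (sign x) x (scale G sa (lmulʷ a P))         ≈⟨ lmul-scale (sign x) x sa (lmulʷ a P) ⟩
    scale G sa (lmul (sign x) x (lmulʷ a P))         ≈⟨ scale-cong sa (lmul-factor (sign x) x (lmulʷ a P)) ⟩
    scale G sa (scale G (sign x) (lmul 1ℚ x (lmulʷ a P))) ≈⟨ scale-scale sa (sign x) _ ⟩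
    scale G (sa * sign x) (lmul 1ℚ x (lmulʷ a P))    ≡⟨ cong (λ s → scale G s (lmul 1ℚ x (lmulʷ a P))) (trans (ℚP.*-comm sa (sign x)) (sym (sgn-+ (deg G x) (degW G a)))) ⟩
    scale G (sgn (degW G (x ∷ a))) (lmul 1ℚ x (lmulʷ a P)) ≈⟨ scale-cong (sgn (degW G (x ∷ a))) (lmulʷ-∷ x a P) ⟨
    scale G (sgn (degW G (x ∷ a))) (lmulʷ (x ∷ a) P) ∎
    where
    open ≈-Reasoning
    sa = sgn (degW G a)

  derive-++ : ∀ δ a w → derive δ (a ++ w) ≈ rmulʷ (derive δ a) w ++ scale G (sgn (degW G a)) (lmulʷ a (derive δ w))
  derive-++ δ [] w rewrite lmulʷ-[] (derive δ w) = ≈-sym (scale-identity _)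
  derive-++ δ (x ∷ a) w = begin
    headTerm (δ x) (a ++ w) ++ lmul (sign x) x (derive δ (a ++ w))
      ≈⟨ ++-cong (≈-reflexive (headTerm-++ (δ x) a w)) (lmul-cong (sign x) x (derive-++ δ a w)) ⟩
    R ++ lmul (sign x) x (rmulʷ (derive δ a) w ++ scale G (sgn (degW G a)) (lmulʷ a P))
      ≡⟨ cong (R ++_) (lmul-++ (sign x) x (rmulʷ (derive δ a) w) (scale G (sgn (degW G a)) (lmulʷ a P))) ⟩
    R ++ (xL ++ lmul (sign x) x (scale G (sgn (degW G a)) (lmulʷ a P)))
      ≈⟨ ++-congˡ R (++-congˡ xL (lmulʷ-sign-∷ x a P)) ⟩
    R ++ (xL ++ S)                                       ≡⟨ sym (ListP.++-assoc R xL S) ⟩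
    (R ++ xL) ++ S                                       ≡⟨ cong (λ z → (R ++ z) ++ S) (sym (rmulʷ-lmul (sign x) x (derive δ a) w)) ⟩
    (R ++ rmulʷ (lmul (sign x) x (derive δ a)) w) ++ S   ≡⟨ cong (_++ S) (sym (ListP.map-++ _ (headTerm (δ x) a) (lmul (sign x) x (derive δ a)))) ⟩
    rmulʷ (derive δ (x ∷ a)) w ++ S                      ∎
    where
    open ≈-Reasoning
    P = derive δ w
    R = rmulʷ (headTerm (δ x) a) w
    xL = lmul (sign x) x (rmulʷ (derive δ a) w)
    S = scale G (sgn (degW G (x ∷ a))) (lmulʷ (x ∷ a) P)

  lmulᴹ : Maybe (Word G) → Combo G → Combo G
  lmulᴹ nothing P = []
  lmulᴹ (just u) P = lmulʷ u P

  D-lmul : ∀ δ e g P → D δ (lmul e g P) ≈ scale G e (lmulᴹ (δ g) P) ++ lmul (e * sign g) g (D δ P)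
  D-lmul δ e g [] with δ g
  ... | nothing = ≈-refl
  ... | just _ = ≈-refl
  D-lmul δ e g ((c , v) ∷ P) = begin
    scale G (e * c) (headTerm (δ g) v ++ lmul (sign g) g (derive δ v)) ++ D δ (lmul e g P)
      ≈⟨ ++-cong (scale-++ (e * c) (headTerm (δ g) v) (lmul (sign g) g (derive δ v))) (D-lmul δ e g P) ⟩
    (scale G (e * c) (headTerm (δ g) v) ++ scale G (e * c) (lmul (sign g) g (derive δ v))) ++
      (scale G e (lmulᴹ (δ g) P) ++ lmul (e * sign g) g (D δ P))
      ≈⟨ ++-interchange (scale G (e * c) (headTerm (δ g) v)) (scale G (e * c) (lmul (sign g) g (derive δ v))) (scale G e (lmulᴹ (δ g) P)) (lmul (e * sign g) g (D δ P)) ⟩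
    (scale G (e * c) (headTerm (δ g) v) ++ scale G e (lmulᴹ (δ g) P)) ++
      (scale G (e * c) (lmul (sign g) g (derive δ v)) ++ lmul (e * sign g) g (D δ P))
      ≈⟨ ++-cong (heads (δ g)) (++-congʳ (lmul (e * sign g) g (D δ P)) lmul-coefficients) ⟩
    scale G e (lmulᴹ (δ g) ((c , v) ∷ P)) ++ (lmul (e * sign g) g (scale G c (derive δ v)) ++ lmul (e * sign g) g (D δ P))
      ≡⟨ cong (scale G e (lmulᴹ (δ g) ((c , v) ∷ P)) ++_) (sym (lmul-++ (e * sign g) g (scale G c (derive δ v)) (D δ P))) ⟩
    scale G e (lmulᴹ (δ g) ((c , v) ∷ P)) ++ lmul (e * sign g) g (D δ ((c , v) ∷ P)) ∎
    where
    open ≈-Reasoning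
    heads : ∀ M → scale G (e * c) (headTerm M v) ++ scale G e (lmulᴹ M P) ≈ scale G e (lmulᴹ M ((c , v) ∷ P))
    heads nothing = ≈-refl
    heads (just u) = ∷-cong (monomial-coeff (u ++ v) (ℚP.*-identityʳ (e * c))) ≈-refl
    lmul-coefficients : scale G (e * c) (lmul (sign g) g (derive δ v)) ≈ lmul (e * sign g) g (scale G c (derive δ v))
    lmul-coefficients = begin
      scale G (e * c) (lmul (sign g) g (derive δ v))                ≈⟨ scale-cong (e * c) (lmul-factor (sign g) g _) ⟩
      scale G (e * c) (scale G (sign g) (lmul 1ℚ g (derive δ v)))    ≈⟨ scale-scale (e * c) (sign g) _ ⟩
      scale G (e * c * sign g) (lmul 1ℚ g (derive δ v))              ≡⟨ cong (λ s → scale G s (lmul 1ℚ g (derive δ v))) (solve 3 (λ e x c → (e :* c) :* x := (e :* x) :* c) refl e (sign g) c) ⟩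
      scale G (e * sign g * c) (lmul 1ℚ g (derive δ v))              ≈⟨ scale-scale (e * sign g) c _ ⟨
      scale G (e * sign g) (scale G c (lmul 1ℚ g (derive δ v)))      ≈⟨ scale-cong (e * sign g) (lmul-scale 1ℚ g c _) ⟨
      scale G (e * sign g) (lmul 1ℚ g (scale G c (derive δ v)))      ≈⟨ lmul-factor (e * sign g) g _ ⟨
      lmul (e * sign g) g (scale G c (derive δ v))                   ∎

  deriveᴹ : GeneratorMap → Maybe (Word G) → Combo G
  deriveᴹ δ nothing = []
  deriveᴹ δ (just u) = derive δ u

  signᴹ : Maybe (Word G) → ℚ
  signᴹ nothing = 1ℚ
  signᴹ (just u) = sgn (degW G u)

  D-headTerm : ∀ δ M w → D δ (headTerm M w) ≈ rmulʷ (deriveᴹ δ M) w ++ scale G (signᴹ M) (lmulᴹ M (derive δ w))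
  D-headTerm δ nothing w = ≈-refl
  D-headTerm δ (just u) w = ≈-trans (++-identityʳ _) (≈-trans (scale-identity _) (derive-++ δ u w))

  signs-cancel : ∀ g M P → ReversesParityAt g M → scale G (signᴹ M) (lmulᴹ M P) ++ scale G (sign g) (lmulᴹ M P) ≈ []
  signs-cancel g nothing P _ = ≈-refl
  signs-cancel g (just u) P u-parity =
    ≈-trans (scale-+ (sgn (degW G u)) (sign g) (lmulʷ u P))
      (≈-trans (≈-reflexive (cong (λ s → scale G s (lmulʷ u P)) opposite)) (scale-zero (lmulʷ u P)))
    where
    opposite : sgn (degW G u) + sign g ≡ 0ℚ
    opposite rewrite u-parity with isOdd (deg G g)
    ... | true = refl
    ... | false = refl

  ++-cancel-cross : ∀ R₁ S₁ E₁ G₁ R₂ S₂ E₂ G₂ → S₁ ++ E₂ ≈ [] → S₂ ++ E₁ ≈ [] →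
    ((R₁ ++ S₁) ++ (E₁ ++ G₁)) ++ ((R₂ ++ S₂) ++ (E₂ ++ G₂)) ≈ (R₁ ++ R₂) ++ (G₁ ++ G₂)
  ++-cancel-cross R₁ S₁ E₁ G₁ R₂ S₂ E₂ G₂ S₁E₂≈[] S₂E₁≈[] = coeffwise λ mon →
    let c = λ X → coeff G X mon
        expand : ∀ X Y Z W → c ((X ++ Y) ++ (Z ++ W)) ≡ (c X + c Y) + (c Z + c W)
        expand X Y Z W = trans (coeff-++ (X ++ Y) (Z ++ W) mon) (cong₂ _+_ (coeff-++ X Y mon) (coeff-++ Z W mon))
        vanish : ∀ X Y → X ++ Y ≈ [] → c X + c Y ≡ 0ℚ
        vanish X Y XY≈[] = trans (sym (coeff-++ X Y mon)) (coeff-≡ XY≈[] mon)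
    in begin
      c (((R₁ ++ S₁) ++ (E₁ ++ G₁)) ++ ((R₂ ++ S₂) ++ (E₂ ++ G₂)))
        ≡⟨ trans (coeff-++ ((R₁ ++ S₁) ++ (E₁ ++ G₁)) ((R₂ ++ S₂) ++ (E₂ ++ G₂)) mon) (cong₂ _+_ (expand R₁ S₁ E₁ G₁) (expand R₂ S₂ E₂ G₂)) ⟩
      ((c R₁ + c S₁) + (c E₁ + c G₁)) + ((c R₂ + c S₂) + (c E₂ + c G₂))
        ≡⟨ solve 8 (λ r₁ s₁ e₁ g₁ r₂ s₂ e₂ g₂ → ((r₁ :+ s₁) :+ (e₁ :+ g₁)) :+ ((r₂ :+ s₂) :+ (e₂ :+ g₂))
                      := ((r₁ :+ r₂) :+ (g₁ :+ g₂)) :+ ((s₁ :+ e₂) :+ (s₂ :+ e₁))) refl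
                   (c R₁) (c S₁) (c E₁) (c G₁) (c R₂) (c S₂) (c E₂) (c G₂) ⟩
      ((c R₁ + c R₂) + (c G₁ + c G₂)) + ((c S₁ + c E₂) + (c S₂ + c E₁))
        ≡⟨ cong₂ (λ a b → ((c R₁ + c R₂) + (c G₁ + c G₂)) + (a + b)) (vanish S₁ E₂ S₁E₂≈[]) (vanish S₂ E₁ S₂E₁≈[]) ⟩
      ((c R₁ + c R₂) + (c G₁ + c G₂)) + (0ℚ + 0ℚ)
        ≡⟨ ℚP.+-identityʳ _ ⟩
      (c R₁ + c R₂) + (c G₁ + c G₂)
        ≡⟨ sym (expand R₁ R₂ G₁ G₂) ⟩
      c ((R₁ ++ R₂) ++ (G₁ ++ G₂)) ∎
    where open ≡-Reasoning

  anticommutator : GeneratorMap → GeneratorMap → Word G → Combo G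
  anticommutator δ₁ δ₂ w = D δ₁ (derive δ₂ w) ++ D δ₂ (derive δ₁ w)

  D-derive-∷ : ∀ δ₁ δ₂ g w → D δ₁ (derive δ₂ (g ∷ w)) ≈
    (rmulʷ (deriveᴹ δ₁ (δ₂ g)) w ++ scale G (signᴹ (δ₂ g)) (lmulᴹ (δ₂ g) (derive δ₁ w))) ++
    (scale G (sign g) (lmulᴹ (δ₁ g) (derive δ₂ w)) ++ lmul (sign g * sign g) g (D δ₁ (derive δ₂ w)))
  D-derive-∷ δ₁ δ₂ g w rewrite extend-++ (derive δ₁) (headTerm (δ₂ g) w) (lmul (sign g) g (derive δ₂ w)) =
    ++-cong (D-headTerm δ₁ (δ₂ g) w) (D-lmul δ₁ (sign g) g (derive δ₂ w))

  anticommutator-∷ : ∀ δ₁ δ₂ → ReversesParity δ₁ → ReversesParity δ₂ → ∀ g w →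
    anticommutator δ₁ δ₂ (g ∷ w) ≈ (rmulʷ (deriveᴹ δ₁ (δ₂ g)) w ++ rmulʷ (deriveᴹ δ₂ (δ₁ g)) w) ++ lmul 1ℚ g (anticommutator δ₁ δ₂ w)
  anticommutator-∷ δ₁ δ₂ δ₁-parity δ₂-parity g w = begin
    anticommutator δ₁ δ₂ (g ∷ w)                          ≈⟨ ++-cong (D-derive-∷ δ₁ δ₂ g w) (D-derive-∷ δ₂ δ₁ g w) ⟩
    ((R₁ ++ S₁) ++ (E₁ ++ G₁)) ++ ((R₂ ++ S₂) ++ (E₂ ++ G₂)) ≈⟨ ++-cancel-cross R₁ S₁ E₁ G₁ R₂ S₂ E₂ G₂ S₁E₂≈[] S₂E₁≈[] ⟩
    (R₁ ++ R₂) ++ (G₁ ++ G₂)                              ≡⟨ cong ((R₁ ++ R₂) ++_) (sym (lmul-++ ε² g (D δ₁ (derive δ₂ w)) (D δ₂ (derive δ₁ w)))) ⟩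
    (R₁ ++ R₂) ++ lmul ε² g (anticommutator δ₁ δ₂ w)      ≡⟨ cong (λ e → (R₁ ++ R₂) ++ lmul e g (anticommutator δ₁ δ₂ w)) (sgn-sq (deg G g)) ⟩
    (R₁ ++ R₂) ++ lmul 1ℚ g (anticommutator δ₁ δ₂ w)      ∎
    where
    open ≈-Reasoning
    ε² = sign g * sign g
    R₁ = rmulʷ (deriveᴹ δ₁ (δ₂ g)) w
    S₁ = scale G (signᴹ (δ₂ g)) (lmulᴹ (δ₂ g) (derive δ₁ w))
    E₁ = scale G (sign g) (lmulᴹ (δ₁ g) (derive δ₂ w))
    G₁ = lmul ε² g (D δ₁ (derive δ₂ w))
    R₂ = rmulʷ (deriveᴹ δ₂ (δ₁ g)) w
    S₂ = scale G (signᴹ (δ₁ g)) (lmulᴹ (δ₁ g) (derive δ₂ w))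
    E₂ = scale G (sign g) (lmulᴹ (δ₂ g) (derive δ₁ w))
    G₂ = lmul ε² g (D δ₂ (derive δ₁ w))
    S₁E₂≈[] : S₁ ++ E₂ ≈ []
    S₁E₂≈[] = signs-cancel g (δ₂ g) (derive δ₁ w) (δ₂-parity g)
    S₂E₁≈[] : S₂ ++ E₁ ≈ []
    S₂E₁≈[] = signs-cancel g (δ₁ g) (derive δ₂ w) (δ₁-parity g)

  ImageKilled : GeneratorMap → Set
  ImageKilled δ = ∀ g u → δ g ≡ just u → All (λ x → δ x ≡ nothing) u

  derive-vanishing : ∀ δ u → All (λ x → δ x ≡ nothing) u → derive δ u ≡ []
  derive-vanishing δ [] _ = refl
  derive-vanishing δ (x ∷ u) (δx≡0 ∷ δu≡0) rewrite δx≡0 | derive-vanishing δ u δu≡0 = refl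

  deriveᴹ-image : ∀ δ → ImageKilled δ → ∀ g → deriveᴹ δ (δ g) ≡ []
  deriveᴹ-image δ δ-killed g with δ g in δg≡
  ... | nothing = refl
  ... | just u = derive-vanishing δ u (δ-killed g u δg≡)

  D-derive-vanishing : ∀ δ → ReversesParity δ → ImageKilled δ → ∀ w → D δ (derive δ w) ≈ []
  D-derive-vanishing δ δ-parity δ-killed [] = ≈-refl
  D-derive-vanishing δ δ-parity δ-killed (g ∷ w) = begin
    D δ (derive δ (g ∷ w))                ≈⟨ D-derive-∷ δ δ g w ⟩
    (rmulʷ (deriveᴹ δ (δ g)) w ++ S) ++ (E ++ lmul (sign g * sign g) g (D δ (derive δ w)))
      ≈⟨ ++-cong (≈-reflexive (cong (λ z → rmulʷ z w ++ S) (deriveᴹ-image δ δ-killed g)))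
                 (++-congˡ E (lmul-cong (sign g * sign g) g (D-derive-vanishing δ δ-parity δ-killed w))) ⟩
    S ++ (E ++ [])                        ≈⟨ ++-congˡ S (++-identityʳ E) ⟩
    S ++ E                                ≈⟨ signs-cancel g (δ g) (derive δ w) (δ-parity g) ⟩
    []                                    ∎
    where
    open ≈-Reasoning
    S = scale G (signᴹ (δ g)) (lmulᴹ (δ g) (derive δ w))
    E = scale G (sign g) (lmulᴹ (δ g) (derive δ w))

  D-extend : ∀ δ T p → D δ (extend T p) ≈ extend (λ w → D δ (T w)) p
  D-extend δ T [] = ≈-refl
  D-extend δ T ((c , w) ∷ p) rewrite extend-++ (derive δ) (scale G c (T w)) (extend T p) =
    ++-cong (extend-scale (derive δ) c (T w)) (D-extend δ T p)

  extend-zero : ∀ p → extend (λ _ → []) p ≡ []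
  extend-zero [] = refl
  extend-zero ((c , w) ∷ p) = extend-zero p

  D²≈[] : ∀ δ → ReversesParity δ → ImageKilled δ → ∀ p → D δ (D δ p) ≈ []
  D²≈[] δ δ-parity δ-killed p = begin
    D δ (D δ p)                        ≈⟨ D-extend δ (derive δ) p ⟩
    extend (λ w → D δ (derive δ w)) p  ≈⟨ extend-congˡ (D-derive-vanishing δ δ-parity δ-killed) p ⟩
    extend (λ _ → []) p                ≡⟨ extend-zero p ⟩
    []                                 ∎
    where open ≈-Reasoning

  derive-preserves-weight : ∀ δ f → (∀ g u → δ g ≡ just u → weight f u ≡ f g) →
    ∀ w → AllWords (λ v → weight f v ≡ weight f w) (derive δ w)
  derive-preserves-weight δ f δ-weight [] = []
  derive-preserves-weight δ f δ-weight (g ∷ w) =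
    AllWords-++ (headTerm (δ g) w) _ (head (δ g) refl)
      (AllWords-lmul (sign g) g (derive δ w) (λ v eq → cong (f g ℕ.+_) eq) (derive-preserves-weight δ f δ-weight w))
    where
    head : ∀ M → δ g ≡ M → AllWords (λ v → weight f v ≡ weight f (g ∷ w)) (headTerm M w)
    head nothing _ = []
    head (just u) δg≡u = trans (weight-++ f u w) (cong (ℕ._+ weight f w) (δ-weight g u δg≡u)) ∷ []

  derive-raises-weight : ∀ δ f → (∀ g u → δ g ≡ just u → f g ℕ.≤ weight f u) →
    ∀ w → AllWords (λ v → weight f w ℕ.≤ weight f v) (derive δ w)
  derive-raises-weight δ f δ-weight [] = []
  derive-raises-weight δ f δ-weight (g ∷ w) =
    AllWords-++ (headTerm (δ g) w) _ (head (δ g) refl)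
      (AllWords-lmul (sign g) g (derive δ w) (λ v le → ℕP.+-monoʳ-≤ (f g) le) (derive-raises-weight δ f δ-weight w))
    where
    head : ∀ M → δ g ≡ M → AllWords (λ v → weight f (g ∷ w) ℕ.≤ weight f v) (headTerm M w)
    head nothing _ = []
    head (just u) δg≡u = subst (f g ℕ.+ weight f w ℕ.≤_) (sym (weight-++ f u w)) (ℕP.+-monoˡ-≤ (weight f w) (δ-weight g u δg≡u)) ∷ []

  module _ (f : Gen G → ℕ) {P : ℕ → Set} (P? : Decidable P) where

    restrict : Combo G → Combo G
    restrict = filter (λ t → P? (weight f (proj₂ t)))

    evalNF-indicator-weight : ∀ w mon → weight f w ≢ weight f mon → evalNF (indicator mon) (normalize G w) ≡ 0ℚ
    evalNF-indicator-weight w mon w≢mon with normalize G w | normalize-weight f w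
    ... | nothing | _ = refl
    ... | just (s , w′) | w′-weight =
      trans (cong (s *_) (indicator-≢ mon w′ (λ w′≡mon → w≢mon (trans (sym w′-weight) (cong (weight f) w′≡mon))))) (ℚP.*-zeroʳ s)

    evaluate-restrict-in : ∀ mon → P (weight f mon) → ∀ p → evaluate (indicator mon) (restrict p) ≡ evaluate (indicator mon) p
    evaluate-restrict-in mon P-mon [] = refl
    evaluate-restrict-in mon P-mon ((c , w) ∷ p) with P? (weight f w)
    ... | yes _ = cong (c * evalNF (indicator mon) (normalize G w) +_) (evaluate-restrict-in mon P-mon p)
    ... | no ¬P-w = sym (begin
      c * evalNF (indicator mon) (normalize G w) + evaluate (indicator mon) p
        ≡⟨ cong (λ x → c * x + evaluate (indicator mon) p) (evalNF-indicator-weight w mon (λ eq → ¬P-w (subst P (sym eq) P-mon))) ⟩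
      c * 0ℚ + evaluate (indicator mon) p   ≡⟨ cong (_+ evaluate (indicator mon) p) (ℚP.*-zeroʳ c) ⟩
      0ℚ + evaluate (indicator mon) p       ≡⟨ ℚP.+-identityˡ _ ⟩
      evaluate (indicator mon) p            ≡⟨ sym (evaluate-restrict-in mon P-mon p) ⟩
      evaluate (indicator mon) (restrict p) ∎)
      where open ≡-Reasoning

    evaluate-restrict-out : ∀ mon → ¬ P (weight f mon) → ∀ p → evaluate (indicator mon) (restrict p) ≡ 0ℚ
    evaluate-restrict-out mon ¬P-mon [] = refl
    evaluate-restrict-out mon ¬P-mon ((c , w) ∷ p) with P? (weight f w)
    ... | yes P-w = trans (cong₂ _+_ (trans (cong (c *_) (evalNF-indicator-weight w mon (λ eq → ¬P-mon (subst P eq P-w)))) (ℚP.*-zeroʳ c))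
                                     (evaluate-restrict-out mon ¬P-mon p))
                          (ℚP.+-identityˡ 0ℚ)
    ... | no _ = evaluate-restrict-out mon ¬P-mon p

    restrict-cong : ∀ {p q} → p ≈ q → restrict p ≈ restrict q
    restrict-cong {p} {q} p≈q = coeffwise λ mon →
      trans (coeff≡evaluate (restrict p) mon) (trans (restricted mon) (sym (coeff≡evaluate (restrict q) mon)))
      where
      restricted : ∀ mon → evaluate (indicator mon) (restrict p) ≡ evaluate (indicator mon) (restrict q)
      restricted mon with P? (weight f mon)
      ... | yes P-mon = begin
        evaluate (indicator mon) (restrict p)  ≡⟨ evaluate-restrict-in mon P-mon p ⟩
        evaluate (indicator mon) p             ≡⟨ evaluate-cong (indicator mon) p≈q ⟩
        evaluate (indicator mon) q             ≡⟨ evaluate-restrict-in mon P-mon q ⟨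
        evaluate (indicator mon) (restrict q)  ∎
        where open ≡-Reasoning
      ... | no ¬P-mon = trans (evaluate-restrict-out mon ¬P-mon p) (sym (evaluate-restrict-out mon ¬P-mon q))

    restrict-accept : ∀ {c w} p → P (weight f w) → restrict ((c , w) ∷ p) ≡ (c , w) ∷ restrict p
    restrict-accept {w = w} p P-w with P? (weight f w)
    ... | yes _ = refl
    ... | no ¬P-w = ⊥-elim (¬P-w P-w)

    restrict-reject : ∀ {c w} p → ¬ P (weight f w) → restrict ((c , w) ∷ p) ≡ restrict p
    restrict-reject {w = w} p ¬P-w with P? (weight f w)
    ... | yes P-w = ⊥-elim (¬P-w P-w)
    ... | no _ = refl

    restrict-preserves : ∀ {Q : Word G → Set} {p} → AllWords Q p → AllWords Q (restrict p)
    restrict-preserves = AllP.filter⁺ _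

    restrict-satisfies : ∀ p → AllWords (λ v → P (weight f v)) (restrict p)
    restrict-satisfies = AllP.all-filter _

    restrict-all : ∀ p → AllWords (λ v → P (weight f v)) p → restrict p ≡ p
    restrict-all [] _ = refl
    restrict-all ((c , w) ∷ p) (P-w ∷ P-p) with P? (weight f w)
    ... | yes _ = cong ((c , w) ∷_) (restrict-all p P-p)
    ... | no ¬P-w = ⊥-elim (¬P-w P-w)

    restrict-none : ∀ p → AllWords (λ v → ¬ P (weight f v)) p → restrict p ≡ []
    restrict-none [] _ = refl
    restrict-none ((c , w) ∷ p) (¬P-w ∷ ¬P-p) with P? (weight f w)
    ... | yes P-w = ⊥-elim (¬P-w P-w)
    ... | no _ = restrict-none p ¬P-p

    restrict-++ : ∀ p q → restrict (p ++ q) ≡ restrict p ++ restrict q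
    restrict-++ = ListP.filter-++ _

    restrict-scale : ∀ a p → restrict (scale G a p) ≡ scale G a (restrict p)
    restrict-scale a [] = refl
    restrict-scale a ((c , w) ∷ p) with P? (weight f w)
    ... | yes _ = cong ((a * c , w) ∷_) (restrict-scale a p)
    ... | no _ = restrict-scale a p

    restrict-extend : ∀ T p → restrict (extend T p) ≡ extend (λ w → restrict (T w)) p
    restrict-extend T [] = refl
    restrict-extend T ((c , w) ∷ p) =
      trans (restrict-++ (scale G c (T w)) (extend T p)) (cong₂ _++_ (restrict-scale c (T w)) (restrict-extend T p))

    restrict-extend-homogeneous : ∀ T → (∀ w → AllWords (λ v → weight f v ≡ weight f w) (T w)) →
      ∀ p → restrict (extend T p) ≡ extend T (restrict p)
    restrict-extend-homogeneous T T-weight [] = refl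
    restrict-extend-homogeneous T T-weight ((c , w) ∷ p)
      rewrite restrict-++ (scale G c (T w)) (extend T p) | restrict-scale c (T w) with P? (weight f w)
    ... | yes P-w = cong₂ _++_ (cong (scale G c) (restrict-all (T w) (All.map (λ eq → subst P (sym eq) P-w) (T-weight w))))
                               (restrict-extend-homogeneous T T-weight p)
    ... | no ¬P-w = cong₂ _++_ (cong (scale G c) (restrict-none (T w) (All.map (λ eq P-v → ¬P-w (subst P eq P-v)) (T-weight w))))
                               (restrict-extend-homogeneous T T-weight p)

  restrict-split : ∀ f {P : ℕ → Set} (P? : Decidable P) p → p ≈ restrict f P? p ++ restrict f (λ x → ¬? (P? x)) p
  restrict-split f P? [] = ≈-refl
  restrict-split f P? ((c , w) ∷ p) with P? (weight f w)
  ... | yes _ = ∷-cong ≈-refl (restrict-split f P? p)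
  ... | no _ = ≈-trans (∷-cong ≈-refl (restrict-split f P? p)) (++-swap (monomial c w) (restrict f P? p) _)

  component : (Gen G → ℕ) → ℕ → Combo G → Combo G
  component f k = restrict f (ℕP._≟ k)

  component-rmulʷ : ∀ f a X w → component f (a ℕ.+ weight f w) (rmulʷ X w) ≡ rmulʷ (component f a X) w
  component-rmulʷ f a [] w = refl
  component-rmulʷ f a ((c , v) ∷ X) w with weight f v ℕP.≟ a
  ... | yes eq = begin
    component f (a ℕ.+ weight f w) ((c , v ++ w) ∷ rmulʷ X w)  ≡⟨ restrict-accept f (ℕP._≟ (a ℕ.+ weight f w)) (rmulʷ X w) (trans (weight-++ f v w) (cong (ℕ._+ weight f w) eq)) ⟩
    (c , v ++ w) ∷ component f (a ℕ.+ weight f w) (rmulʷ X w)  ≡⟨ cong ((c , v ++ w) ∷_) (component-rmulʷ f a X w) ⟩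
    rmulʷ ((c , v) ∷ component f a X) w                        ≡⟨ cong (λ z → rmulʷ z w) (restrict-accept f (ℕP._≟ a) X eq) ⟨
    rmulʷ (component f a ((c , v) ∷ X)) w                      ∎
    where open ≡-Reasoning
  ... | no ≢ = begin
    component f (a ℕ.+ weight f w) ((c , v ++ w) ∷ rmulʷ X w)  ≡⟨ restrict-reject f (ℕP._≟ (a ℕ.+ weight f w)) {c} {v ++ w} (rmulʷ X w) (λ eq → ≢ (ℕP.+-cancelʳ-≡ (weight f w) _ _ (trans (sym (weight-++ f v w)) eq))) ⟩
    component f (a ℕ.+ weight f w) (rmulʷ X w)                 ≡⟨ component-rmulʷ f a X w ⟩
    rmulʷ (component f a X) w                                  ≡⟨ cong (λ z → rmulʷ z w) (restrict-reject f (ℕP._≟ a) {c} {v} X ≢) ⟨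
    rmulʷ (component f a ((c , v) ∷ X)) w                      ∎
    where open ≡-Reasoning

  component-lmul : ∀ f e g b Y → component f (f g ℕ.+ b) (lmul e g Y) ≡ lmul e g (component f b Y)
  component-lmul f e g b [] = refl
  component-lmul f e g b ((c , v) ∷ Y) with weight f v ℕP.≟ b
  ... | yes eq = begin
    component f (f g ℕ.+ b) ((e * c , g ∷ v) ∷ lmul e g Y)  ≡⟨ restrict-accept f (ℕP._≟ (f g ℕ.+ b)) (lmul e g Y) (cong (f g ℕ.+_) eq) ⟩
    (e * c , g ∷ v) ∷ component f (f g ℕ.+ b) (lmul e g Y)  ≡⟨ cong ((e * c , g ∷ v) ∷_) (component-lmul f e g b Y) ⟩
    lmul e g ((c , v) ∷ component f b Y)                    ≡⟨ cong (lmul e g) (restrict-accept f (ℕP._≟ b) Y eq) ⟨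
    lmul e g (component f b ((c , v) ∷ Y))                  ∎
    where open ≡-Reasoning
  ... | no ≢ = begin
    component f (f g ℕ.+ b) ((e * c , g ∷ v) ∷ lmul e g Y)  ≡⟨ restrict-reject f (ℕP._≟ (f g ℕ.+ b)) {e * c} {g ∷ v} (lmul e g Y) (λ eq → ≢ (ℕP.+-cancelˡ-≡ (f g) _ _ eq)) ⟩
    component f (f g ℕ.+ b) (lmul e g Y)                    ≡⟨ component-lmul f e g b Y ⟩
    lmul e g (component f b Y)                              ≡⟨ cong (lmul e g) (restrict-reject f (ℕP._≟ b) {c} {v} Y ≢) ⟨
    lmul e g (component f b ((c , v) ∷ Y))                  ∎
    where open ≡-Reasoning

  -- The differential d and the homotopy h of a hypergraph

  edge : Fin (m G) → Subset (n G)
  edge e = List.lookup (edges G) e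

  edgeVertices : Fin (m G) → List (Fin (n G))
  edgeVertices e = elems G (edge e)

  data GenView : Gen G → Set where
    vertex : (v : Fin (n G)) → GenView (v ↑ˡ m G)
    edgeGen : (e : Fin (m G)) → GenView (n G ↑ʳ e)

  view : ∀ g → GenView g
  view g = subst GenView (FinP.join-splitAt (n G) (m G) g) (view-split (splitAt (n G) g))
    where
    view-split : (x : Fin (n G) ⊎ Fin (m G)) → GenView (Fin.join (n G) (m G) x)
    view-split (inj₁ v) = vertex v
    view-split (inj₂ e) = edgeGen e

  deg-vertex : ∀ v → deg G (v ↑ˡ m G) ≡ 1
  deg-vertex v rewrite FinP.splitAt-↑ˡ (n G) v (m G) = refl

  deg-edge : ∀ e → deg G (n G ↑ʳ e) ≡ ∣ edge e ∣ ∸ 1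
  deg-edge e rewrite FinP.splitAt-↑ʳ (n G) (m G) e = refl

  dGen-vertex : ∀ v → dGen G (v ↑ˡ m G) ≡ nothing
  dGen-vertex v rewrite FinP.splitAt-↑ˡ (n G) v (m G) = refl

  dGen-edge : ∀ e → dGen G (n G ↑ʳ e) ≡ just (map (_↑ˡ m G) (edgeVertices e))
  dGen-edge e rewrite FinP.splitAt-↑ʳ (n G) (m G) e = refl

  edgeVertices-nonempty : ∀ e → Σ ℕ (λ k → List.length (edgeVertices e) ≡ suc k)
  edgeVertices-nonempty e with All.lookup (nonempty G) (∈-lookup {xs = edges G} e)
  ... | (x , x∈e) with edgeVertices e | ∈-filter⁺ (_∈? edge e) {x = x} {xs = List.allFin (n G)} (∈-allFin x) x∈e
  ... | y ∷ ys | _ = List.length ys , refl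

  degW-vertices : ∀ (vs : List (Fin (n G))) → degW G (map (_↑ˡ m G) vs) ≡ List.length vs
  degW-vertices [] = refl
  degW-vertices (v ∷ vs) rewrite deg-vertex v = cong suc (degW-vertices vs)

  dGen-reverses-parity : ReversesParity (dGen G)
  dGen-reverses-parity g with view g
  ... | vertex v rewrite dGen-vertex v = tt
  ... | edgeGen e rewrite dGen-edge e | degW-vertices (edgeVertices e) | deg-edge e | sym (length-elements (edge e))
    with edgeVertices-nonempty e
  ...   | (k , |e|≡1+k) rewrite |e|≡1+k = isOdd-suc k

  map-sign≡lmul : ∀ g p → map (λ { (c , v) → (sgn (deg G g) * c , g ∷ v) }) p ≡ lmul (sign g) g p
  map-sign≡lmul g [] = refl
  map-sign≡lmul g ((c , v) ∷ p) = cong ((sign g * c , g ∷ v) ∷_) (map-sign≡lmul g p)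

  dWord≡derive : ∀ w → dWord G w ≡ derive (dGen G) w
  dWord≡derive [] = refl
  dWord≡derive (g ∷ w) with dGen G g
  ... | nothing = cong ([] ++_) (trans (map-sign≡lmul g (dWord G w)) (cong (lmul (sign g) g) (dWord≡derive w)))
  ... | just u = cong (monomial 1ℚ (u ++ w) ++_) (trans (map-sign≡lmul g (dWord G w)) (cong (lmul (sign g) g) (dWord≡derive w)))

  D-d : Combo G → Combo G
  D-d = D (dGen G)

  d≡D-d : ∀ p → d G p ≡ D-d p
  d≡D-d [] = refl
  d≡D-d ((c , w) ∷ p) = cong₂ _++_ (cong (scale G c) (dWord≡derive w)) (d≡D-d p)

  edgeVertices-injective : ∀ e e′ → edgeVertices e ≡ edgeVertices e′ → e ≡ e′
  edgeVertices-injective e e′ eq = lookup-injective (simple G) e e′ (elements-injective (edge e) (edge e′) eq)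

  IsUnitEdgeOf : Fin (n G) → Fin (m G) → Set
  IsUnitEdgeOf v e = edgeVertices e ≡ v ∷ []

  isUnitEdgeOf? : ∀ v → Decidable (IsUnitEdgeOf v)
  isUnitEdgeOf? v e = ListP.≡-dec FinP._≟_ (edgeVertices e) (v ∷ [])

  unitEdge : Fin (n G) → Maybe (Fin (m G))
  unitEdge v = List.find (isUnitEdgeOf? v) (List.allFin (m G))

  unitEdge-sound : ∀ v {e} → unitEdge v ≡ just e → IsUnitEdgeOf v e
  unitEdge-sound v = find-sound (isUnitEdgeOf? v) (List.allFin (m G))

  unitEdge-complete : ∀ v e → IsUnitEdgeOf v e → unitEdge v ≡ just e
  unitEdge-complete v e e-unit with find-complete (isUnitEdgeOf? v) (∈-allFin e) e-unit
  ... | (e′ , found) = trans found (cong just (edgeVertices-injective e′ e (trans (unitEdge-sound v found) (sym e-unit))))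

  homotopy : GeneratorMap
  homotopy g with splitAt (n G) g
  ... | inj₁ v = Maybe.map (λ e → (n G ↑ʳ e) ∷ []) (unitEdge v)
  ... | inj₂ e = nothing

  is-just : Maybe (Fin (m G)) → ℕ
  is-just nothing = 0
  is-just (just _) = 1

  is-singleton : List (Fin (n G)) → ℕ
  is-singleton (_ ∷ []) = 1
  is-singleton _ = 0

  unitCount : Gen G → ℕ
  unitCount g with splitAt (n G) g
  ... | inj₁ v = is-just (unitEdge v)
  ... | inj₂ e = is-singleton (edgeVertices e)

  size : Gen G → ℕ
  size g with splitAt (n G) g
  ... | inj₁ v = 1
  ... | inj₂ e = List.length (edgeVertices e)

  homotopy-vertex : ∀ v → homotopy (v ↑ˡ m G) ≡ Maybe.map (λ e → (n G ↑ʳ e) ∷ []) (unitEdge v)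
  homotopy-vertex v rewrite FinP.splitAt-↑ˡ (n G) v (m G) = refl

  homotopy-edge : ∀ e → homotopy (n G ↑ʳ e) ≡ nothing
  homotopy-edge e rewrite FinP.splitAt-↑ʳ (n G) (m G) e = refl

  unitCount-vertex : ∀ v → unitCount (v ↑ˡ m G) ≡ is-just (unitEdge v)
  unitCount-vertex v rewrite FinP.splitAt-↑ˡ (n G) v (m G) = refl

  unitCount-edge : ∀ e → unitCount (n G ↑ʳ e) ≡ is-singleton (edgeVertices e)
  unitCount-edge e rewrite FinP.splitAt-↑ʳ (n G) (m G) e = refl

  size-vertex : ∀ v → size (v ↑ˡ m G) ≡ 1
  size-vertex v rewrite FinP.splitAt-↑ˡ (n G) v (m G) = refl

  size-edge : ∀ e → size (n G ↑ʳ e) ≡ List.length (edgeVertices e)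
  size-edge e rewrite FinP.splitAt-↑ʳ (n G) (m G) e = refl

  deg-unitEdge : ∀ e v → IsUnitEdgeOf v e → deg G (n G ↑ʳ e) ≡ 0
  deg-unitEdge e v e-unit rewrite deg-edge e | sym (length-elements (edge e)) = cong (λ vs → List.length vs ∸ 1) e-unit

  homotopy-reverses-parity : ReversesParity homotopy
  homotopy-reverses-parity g with view g
  ... | edgeGen e rewrite homotopy-edge e = tt
  ... | vertex v rewrite homotopy-vertex v with unitEdge v in found
  ...   | nothing = tt
  ...   | just e rewrite deg-vertex v | deg-unitEdge e v (unitEdge-sound v found) = refl

  D-h : Combo G → Combo G
  D-h = D homotopy

  units : Word G → ℕ
  units = weight unitCount

  totalSize : Word G → ℕ
  totalSize = weight size

  dGen-image-killed : ImageKilled (dGen G)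
  dGen-image-killed g u eq with view g
  ... | vertex v rewrite dGen-vertex v with eq
  ...   | ()
  dGen-image-killed g u eq | edgeGen e rewrite dGen-edge e with eq
  ... | refl = AllP.map⁺ (All.universal dGen-vertex (edgeVertices e))

  weight-vertices : ∀ f (vs : List (Fin (n G))) → (∀ v → f (v ↑ˡ m G) ≡ 1) → weight f (map (_↑ˡ m G) vs) ≡ List.length vs
  weight-vertices f [] f≡1 = refl
  weight-vertices f (v ∷ vs) f≡1 rewrite f≡1 v = cong suc (weight-vertices f vs f≡1)

  size-dGen : ∀ g u → dGen G g ≡ just u → totalSize u ≡ size g
  size-dGen g u eq with view g
  ... | vertex v rewrite dGen-vertex v with eq
  ...   | ()
  size-dGen g u eq | edgeGen e rewrite dGen-edge e with eq
  ... | refl rewrite size-edge e = weight-vertices size (edgeVertices e) size-vertex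

  size-homotopy : ∀ g u → homotopy g ≡ just u → totalSize u ≡ size g
  size-homotopy g u eq with view g
  ... | edgeGen e rewrite homotopy-edge e with eq
  ...   | ()
  size-homotopy g u eq | vertex v rewrite homotopy-vertex v with unitEdge v in found
  ... | nothing with eq
  ...   | ()
  size-homotopy g u eq | vertex v | just e with eq
  ... | refl rewrite size-edge e | unitEdge-sound v found | size-vertex v = refl

  units-homotopy : ∀ g u → homotopy g ≡ just u → units u ≡ unitCount g
  units-homotopy g u eq with view g
  ... | edgeGen e rewrite homotopy-edge e with eq
  ...   | ()
  units-homotopy g u eq | vertex v rewrite homotopy-vertex v with unitEdge v in found
  ... | nothing with eq
  ...   | ()
  units-homotopy g u eq | vertex v | just e with eq
  ... | refl rewrite unitCount-edge e | unitEdge-sound v found | unitCount-vertex v | found = refl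

  units-dGen : ∀ g u → dGen G g ≡ just u → unitCount g ℕ.≤ units u
  units-dGen g u eq with view g
  ... | vertex v rewrite dGen-vertex v with eq
  ...   | ()
  units-dGen g u eq | edgeGen e rewrite dGen-edge e with eq
  ... | refl rewrite unitCount-edge e with edgeVertices e in vertices
  ...   | [] = ℕ.z≤n
  ...   | v ∷ [] rewrite unitCount-vertex v | unitEdge-complete v e vertices = ℕ.s≤s ℕ.z≤n
  ...   | _ ∷ _ ∷ _ = ℕ.z≤n

  unitCount≤size : ∀ g → unitCount g ℕ.≤ size g
  unitCount≤size g with view g
  ... | vertex v rewrite unitCount-vertex v | size-vertex v with unitEdge v
  ...   | nothing = ℕ.z≤n
  ...   | just _ = ℕ.s≤s ℕ.z≤n
  unitCount≤size g | edgeGen e rewrite unitCount-edge e | size-edge e with edgeVertices e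
  ... | [] = ℕ.z≤n
  ... | _ ∷ [] = ℕ.s≤s ℕ.z≤n
  ... | _ ∷ _ ∷ _ = ℕ.z≤n

  units≤totalSize : ∀ w → units w ℕ.≤ totalSize w
  units≤totalSize [] = ℕ.z≤n
  units≤totalSize (g ∷ w) = ℕP.+-mono-≤ (unitCount≤size g) (units≤totalSize w)

  homotopy-vanishes : ∀ g → unitCount g ≡ 0 → homotopy g ≡ nothing
  homotopy-vanishes g no-unit with view g
  ... | edgeGen e = homotopy-edge e
  ... | vertex v rewrite homotopy-vertex v | unitCount-vertex v with unitEdge v
  ...   | nothing = refl
  ...   | just _ with no-unit
  ...     | ()

  homotopy-vanishes-on : ∀ w → units w ≡ 0 → All (λ x → homotopy x ≡ nothing) w
  homotopy-vanishes-on [] _ = []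
  homotopy-vanishes-on (g ∷ w) no-units =
    homotopy-vanishes g (ℕP.m+n≡0⇒m≡0 (unitCount g) no-units) ∷ homotopy-vanishes-on w (ℕP.m+n≡0⇒n≡0 (unitCount g) no-units)

  -- The Euler formula for dh + hd

  dh+hd : Word G → Combo G
  dh+hd = anticommutator (dGen G) homotopy

  component-0-derive-homotopy : ∀ u → component unitCount 0 (derive homotopy u) ≡ []
  component-0-derive-homotopy u with units u ℕP.≟ 0
  ... | yes no-units rewrite derive-vanishing homotopy u (homotopy-vanishes-on u no-units) = refl
  ... | no some-units = restrict-none unitCount (ℕP._≟ 0) (derive homotopy u)
    (All.map (λ same zero → some-units (trans (sym same) zero)) (derive-preserves-weight homotopy unitCount units-homotopy u))

  component-1-unit-generator : ∀ x → unitCount x ≡ 1 → component unitCount 1 (monomial 1ℚ (x ∷ [])) ≡ monomial 1ℚ (x ∷ [])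
  component-1-unit-generator x one = restrict-all unitCount (ℕP._≟ 1) (monomial 1ℚ (x ∷ [])) (trans (ℕP.+-identityʳ _) one ∷ [])

  dh+hd-generator : ∀ g w →
    rmulʷ (component unitCount (unitCount g) (deriveᴹ (dGen G) (homotopy g))) w ++
    rmulʷ (component unitCount (unitCount g) (deriveᴹ homotopy (dGen G g))) w
      ≈ scale G (fromℕ (unitCount g)) (monomial 1ℚ (g ∷ w))
  dh+hd-generator g w with view g
  dh+hd-generator g w | vertex v with unitEdge v in found
  ... | just e
    rewrite unitCount-vertex v | found | homotopy-vertex v | found | dGen-edge e | unitEdge-sound v found | dGen-vertex v
          | component-1-unit-generator (v ↑ˡ m G) (trans (unitCount-vertex v) (cong is-just found)) = ≈-refl
  ... | nothing rewrite unitCount-vertex v | found | homotopy-vertex v | found | dGen-vertex v =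
    ≈-sym (scale-zero (monomial 1ℚ ((v ↑ˡ m G) ∷ w)))
  dh+hd-generator g w | edgeGen e rewrite homotopy-edge e | dGen-edge e | unitCount-edge e with edgeVertices e in vertices
  ... | [] = ≈-sym (scale-zero (monomial 1ℚ ((n G ↑ʳ e) ∷ w)))
  ... | v ∷ [] rewrite homotopy-vertex v | unitEdge-complete v e vertices
                     | component-1-unit-generator (n G ↑ʳ e) (trans (unitCount-edge e) (cong is-singleton vertices)) = ≈-refl
  ... | a ∷ b ∷ r rewrite component-0-derive-homotopy (map (_↑ˡ m G) (a ∷ b ∷ r)) =
    ≈-sym (scale-zero (monomial 1ℚ ((n G ↑ʳ e) ∷ w)))

  component-anticommutator-∷ : ∀ (A B X : Combo G) g w →
    component unitCount (units (g ∷ w)) ((rmulʷ A w ++ rmulʷ B w) ++ lmul 1ℚ g X) ≡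
    (rmulʷ (component unitCount (unitCount g) A) w ++ rmulʷ (component unitCount (unitCount g) B) w) ++
    lmul 1ℚ g (component unitCount (units w) X)
  component-anticommutator-∷ A B X g w = begin
    C (units (g ∷ w)) ((rmulʷ A w ++ rmulʷ B w) ++ lmul 1ℚ g X)
      ≡⟨ restrict-++ unitCount (ℕP._≟ units (g ∷ w)) (rmulʷ A w ++ rmulʷ B w) (lmul 1ℚ g X) ⟩
    C (units (g ∷ w)) (rmulʷ A w ++ rmulʷ B w) ++ C (units (g ∷ w)) (lmul 1ℚ g X)
      ≡⟨ cong (_++ C (units (g ∷ w)) (lmul 1ℚ g X)) (restrict-++ unitCount (ℕP._≟ units (g ∷ w)) (rmulʷ A w) (rmulʷ B w)) ⟩
    (C (units (g ∷ w)) (rmulʷ A w) ++ C (units (g ∷ w)) (rmulʷ B w)) ++ C (units (g ∷ w)) (lmul 1ℚ g X)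
      ≡⟨ cong₂ _++_ (cong₂ _++_ (component-rmulʷ unitCount (unitCount g) A w) (component-rmulʷ unitCount (unitCount g) B w))
                    (component-lmul unitCount 1ℚ g (units w) X) ⟩
    (rmulʷ (C (unitCount g) A) w ++ rmulʷ (C (unitCount g) B) w) ++ lmul 1ℚ g (C (units w) X) ∎
    where
    open ≡-Reasoning
    C = component unitCount

  euler : ∀ w → component unitCount (units w) (dh+hd w) ≈ scale G (fromℕ (units w)) (monomial 1ℚ w)
  euler [] = ≈-sym (scale-zero (monomial 1ℚ []))
  euler (g ∷ w) = begin
    component unitCount (units (g ∷ w)) (dh+hd (g ∷ w))
      ≈⟨ restrict-cong unitCount (ℕP._≟ units (g ∷ w)) (anticommutator-∷ (dGen G) homotopy dGen-reverses-parity homotopy-reverses-parity g w) ⟩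
    component unitCount (units (g ∷ w)) ((rmulʷ A w ++ rmulʷ B w) ++ lmul 1ℚ g (dh+hd w))
      ≡⟨ component-anticommutator-∷ A B (dh+hd w) g w ⟩
    (rmulʷ (component unitCount (unitCount g) A) w ++ rmulʷ (component unitCount (unitCount g) B) w) ++
      lmul 1ℚ g (component unitCount (units w) (dh+hd w))
      ≈⟨ ++-cong (dh+hd-generator g w) (lmul-cong 1ℚ g (euler w)) ⟩
    scale G qg (monomial 1ℚ (g ∷ w)) ++ lmul 1ℚ g (scale G qw (monomial 1ℚ w))
      ≈⟨ ++-congˡ (scale G qg (monomial 1ℚ (g ∷ w))) (monomial-coeff (g ∷ w) (ℚP.*-identityˡ (qw * 1ℚ))) ⟩
    scale G qg (monomial 1ℚ (g ∷ w)) ++ scale G qw (monomial 1ℚ (g ∷ w))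
      ≈⟨ scale-+ qg qw (monomial 1ℚ (g ∷ w)) ⟩
    scale G (qg + qw) (monomial 1ℚ (g ∷ w))
      ≡⟨ cong (λ q → scale G q (monomial 1ℚ (g ∷ w))) (sym (fromℕ-+ (unitCount g) (units w))) ⟩
    scale G (fromℕ (units (g ∷ w))) (monomial 1ℚ (g ∷ w)) ∎
    where
    open ≈-Reasoning
    A = deriveᴹ (dGen G) (homotopy g)
    B = deriveᴹ homotopy (dGen G g)
    qg = fromℕ (unitCount g)
    qw = fromℕ (units w)

  euler-homogeneous : ∀ k p → AllWords (λ v → units v ≡ k) p →
    component unitCount k (D-d (D-h p)) ++ component unitCount k (D-h (D-d p)) ≈ scale G (fromℕ k) p
  euler-homogeneous k p units≡k = begin
    C (D-d (D-h p)) ++ C (D-h (D-d p))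
      ≈⟨ ++-cong (restrict-cong unitCount (ℕP._≟ k) (D-extend (dGen G) (derive homotopy) p))
                 (restrict-cong unitCount (ℕP._≟ k) (D-extend homotopy (derive (dGen G)) p)) ⟩
    C (extend T₁ p) ++ C (extend T₂ p)
      ≡⟨ sym (restrict-++ unitCount (ℕP._≟ k) (extend T₁ p) (extend T₂ p)) ⟩
    C (extend T₁ p ++ extend T₂ p)
      ≈⟨ restrict-cong unitCount (ℕP._≟ k) (extend-+ T₁ T₂ p) ⟩
    C (extend dh+hd p)
      ≡⟨ restrict-extend unitCount (ℕP._≟ k) dh+hd p ⟩
    extend (λ w → C (dh+hd w)) p
      ≈⟨ extend-congˡ-on (λ w units≡ → subst (λ j → component unitCount j (dh+hd w) ≈ scale G (fromℕ j) (monomial 1ℚ w)) units≡ (euler w)) p units≡k ⟩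
    extend (λ w → scale G (fromℕ k) (monomial 1ℚ w)) p
      ≈⟨ extend-scaled-monomial (fromℕ k) p ⟩
    scale G (fromℕ k) p ∎
    where
    open ≈-Reasoning
    C = component unitCount k
    T₁ = λ w → D-d (derive homotopy w)
    T₂ = λ w → D-h (derive (dGen G) w)

  -- Cocycles whose words all contain unit letters are coboundaries

  ++-negate-cancel : ∀ X Y V → (Y ++ scale G (- 1ℚ) V) ++ (X ++ V) ≈ X ++ Y
  ++-negate-cancel X Y V = coeffwise λ mon → begin
    coeff G ((Y ++ scale G (- 1ℚ) V) ++ (X ++ V)) mon
      ≡⟨ trans (coeff-++ (Y ++ scale G (- 1ℚ) V) (X ++ V) mon)
               (cong₂ _+_ (trans (coeff-++ Y (scale G (- 1ℚ) V) mon) (cong (coeff G Y mon +_) (coeff-scale (- 1ℚ) V mon))) (coeff-++ X V mon)) ⟩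
    (coeff G Y mon + - 1ℚ * coeff G V mon) + (coeff G X mon + coeff G V mon)
      ≡⟨ solve 3 (λ x y v → (y :+ (:- con 1ℚ) :* v) :+ (x :+ v) := x :+ y) refl (coeff G X mon) (coeff G Y mon) (coeff G V mon) ⟩
    coeff G X mon + coeff G Y mon
      ≡⟨ coeff-++ X Y mon ⟨
    coeff G (X ++ Y) mon ∎
    where open ≡-Reasoning

  ++-negate-restore : ∀ X Y → X ≈ (X ++ Y) ++ scale G (- 1ℚ) Y
  ++-negate-restore X Y = coeffwise λ mon → sym (begin
    coeff G ((X ++ Y) ++ scale G (- 1ℚ) Y) mon
      ≡⟨ trans (coeff-++ (X ++ Y) (scale G (- 1ℚ) Y) mon) (cong₂ _+_ (coeff-++ X Y mon) (coeff-scale (- 1ℚ) Y mon)) ⟩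
    (coeff G X mon + coeff G Y mon) + - 1ℚ * coeff G Y mon
      ≡⟨ solve 2 (λ x y → (x :+ y) :+ (:- con 1ℚ) :* y := x) refl (coeff G X mon) (coeff G Y mon) ⟩
    coeff G X mon ∎)
    where open ≡-Reasoning

  upper : ℕ → Combo G → Combo G
  upper k = restrict unitCount (λ x → ¬? (x ℕP.≟ k))

  upper-units : ∀ k p → AllWords (λ v → k ℕ.≤ units v) p → AllWords (λ v → suc k ℕ.≤ units v) (upper k p)
  upper-units k p units≥k =
    All.zipWith (λ { (k≤ , ≢k) → ℕP.≤∧≢⇒< k≤ (λ eq → ≢k (sym eq)) })
      (restrict-preserves unitCount (λ x → ¬? (x ℕP.≟ k)) units≥k , restrict-satisfies unitCount (λ x → ¬? (x ℕP.≟ k)) p)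

  D-d-raises-units : ∀ {k} p → AllWords (λ v → k ℕ.≤ units v) p → AllWords (λ v → k ℕ.≤ units v) (D-d p)
  D-d-raises-units = AllWords-extend (derive (dGen G))
    (λ w k≤w → All.map (ℕP.≤-trans k≤w) (derive-raises-weight (dGen G) unitCount units-dGen w))

  D-h-preserves-units : ∀ {k} p → AllWords (λ v → units v ≡ k) p → AllWords (λ v → units v ≡ k) (D-h p)
  D-h-preserves-units = AllWords-extend (derive homotopy)
    (λ w w≡k → All.map (λ same → trans same w≡k) (derive-preserves-weight homotopy unitCount units-homotopy w))

  D-preserves-size : ∀ δ → (∀ g u → δ g ≡ just u → totalSize u ≡ size g) →
    ∀ {W} p → AllWords (λ v → totalSize v ℕ.≤ W) p → AllWords (λ v → totalSize v ℕ.≤ W) (D δ p)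
  D-preserves-size δ δ-size = AllWords-extend (derive δ)
    (λ w w≤W → All.map (λ same → subst (ℕ._≤ _) (sym same) w≤W) (derive-preserves-weight δ size δ-size w))

  module LowestUnits (k′ : ℕ) (u : Combo G) (units≥k : AllWords (λ v → suc k′ ℕ.≤ units v) u) (du≈[] : D-d u ≈ []) where

    k : ℕ
    k = suc k′

    lowest : Combo G
    lowest = component unitCount k u

    higher : Combo G
    higher = upper k u

    b₀ : Combo G
    b₀ = D-h lowest

    ι : ℚ
    ι = (ℚ.1/ fromℕ k) {{fromℕ-suc-nonZero k′}}

    b : Combo G
    b = scale G ι b₀

    excess : Combo G
    excess = upper k (D-d b₀)

    rest : Combo G
    rest = higher ++ scale G (- 1ℚ) (scale G ι excess)

    u≈lowest+higher : u ≈ lowest ++ higher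
    u≈lowest+higher = restrict-split unitCount (ℕP._≟ k) u

    lowest-units : AllWords (λ v → units v ≡ k) lowest
    lowest-units = restrict-satisfies unitCount (ℕP._≟ k) u

    lowest-of-D-d-lowest : component unitCount k (D-d lowest) ≈ []
    lowest-of-D-d-lowest = begin
      C (D-d lowest)                      ≈⟨ ++-identityʳ (C (D-d lowest)) ⟨
      C (D-d lowest) ++ []                ≡⟨ cong (C (D-d lowest) ++_) (sym higher-vanishes) ⟩
      C (D-d lowest) ++ C (D-d higher)    ≡⟨ sym (restrict-++ unitCount (ℕP._≟ k) (D-d lowest) (D-d higher)) ⟩
      C (D-d lowest ++ D-d higher)        ≡⟨ cong C (sym (extend-++ (derive (dGen G)) lowest higher)) ⟩
      C (D-d (lowest ++ higher))          ≈⟨ restrict-cong unitCount (ℕP._≟ k) (D-cong (dGen G) dGen-reverses-parity u≈lowest+higher) ⟨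
      C (D-d u)                           ≈⟨ restrict-cong unitCount (ℕP._≟ k) du≈[] ⟩
      []                                  ∎
      where
      open ≈-Reasoning
      C = component unitCount k
      higher-vanishes : C (D-d higher) ≡ []
      higher-vanishes = restrict-none unitCount (ℕP._≟ k) (D-d higher)
        (All.map (λ k<v v≡k → ℕP.<-irrefl (sym v≡k) k<v) (D-d-raises-units higher (upper-units k u units≥k)))

    lowest-of-D-d-b₀ : component unitCount k (D-d b₀) ≈ scale G (fromℕ k) lowest
    lowest-of-D-d-b₀ = begin
      C (D-d (D-h lowest))                            ≈⟨ ++-identityʳ (C (D-d (D-h lowest))) ⟨
      C (D-d (D-h lowest)) ++ []                      ≈⟨ ++-congˡ (C (D-d (D-h lowest))) hd-vanishes ⟨
      C (D-d (D-h lowest)) ++ C (D-h (D-d lowest))    ≈⟨ euler-homogeneous k lowest lowest-units ⟩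
      scale G (fromℕ k) lowest                        ∎
      where
      open ≈-Reasoning
      C = component unitCount k
      hd-vanishes : C (D-h (D-d lowest)) ≈ []
      hd-vanishes = begin
        C (D-h (D-d lowest))  ≡⟨ restrict-extend-homogeneous unitCount (ℕP._≟ k) (derive homotopy)
                                   (derive-preserves-weight homotopy unitCount units-homotopy) (D-d lowest) ⟩
        D-h (C (D-d lowest))  ≈⟨ D-cong homotopy homotopy-reverses-parity lowest-of-D-d-lowest ⟩
        []                    ∎

    D-d-b : D-d b ≈ lowest ++ scale G ι excess
    D-d-b = begin
      D-d (scale G ι b₀)                                        ≈⟨ extend-scale (derive (dGen G)) ι b₀ ⟩
      scale G ι (D-d b₀)                                        ≈⟨ scale-cong ι (restrict-split unitCount (ℕP._≟ k) (D-d b₀)) ⟩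
      scale G ι (component unitCount k (D-d b₀) ++ excess)      ≈⟨ scale-++ ι (component unitCount k (D-d b₀)) excess ⟩
      scale G ι (component unitCount k (D-d b₀)) ++ scale G ι excess
        ≈⟨ ++-congʳ (scale G ι excess) (scale-cong ι lowest-of-D-d-b₀) ⟩
      scale G ι (scale G (fromℕ k) lowest) ++ scale G ι excess  ≈⟨ ++-congʳ (scale G ι excess) (scale-scale ι (fromℕ k) lowest) ⟩
      scale G (ι * fromℕ k) lowest ++ scale G ι excess          ≡⟨ cong (λ x → scale G x lowest ++ scale G ι excess) ι*k≡1 ⟩
      scale G 1ℚ lowest ++ scale G ι excess                     ≈⟨ ++-congʳ (scale G ι excess) (scale-identity lowest) ⟩
      lowest ++ scale G ι excess                                ∎
      where
      open ≈-Reasoning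
      ι*k≡1 : ι * fromℕ k ≡ 1ℚ
      ι*k≡1 = ℚP.*-inverseˡ (fromℕ k) {{fromℕ-suc-nonZero k′}}

    u≈rest+D-d-b : u ≈ rest ++ D-d b
    u≈rest+D-d-b = begin
      u                                                          ≈⟨ u≈lowest+higher ⟩
      lowest ++ higher                                           ≈⟨ ++-negate-cancel lowest higher (scale G ι excess) ⟨
      rest ++ (lowest ++ scale G ι excess)                       ≈⟨ ++-congˡ rest D-d-b ⟨
      rest ++ D-d b                                              ∎
      where open ≈-Reasoning

    D-d-rest : D-d rest ≈ []
    D-d-rest = begin
      D-d rest                                        ≈⟨ D-cong (dGen G) dGen-reverses-parity rest≈ ⟩
      D-d (u ++ scale G (- 1ℚ) (D-d b))               ≡⟨ extend-++ (derive (dGen G)) u (scale G (- 1ℚ) (D-d b)) ⟩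
      D-d u ++ D-d (scale G (- 1ℚ) (D-d b))           ≈⟨ ++-cong du≈[] (extend-scale (derive (dGen G)) (- 1ℚ) (D-d b)) ⟩
      [] ++ scale G (- 1ℚ) (D-d (D-d b))              ≈⟨ scale-≈[] (- 1ℚ) (D²≈[] (dGen G) dGen-reverses-parity dGen-image-killed b) ⟩
      []                                              ∎
      where
      open ≈-Reasoning
      rest≈ : rest ≈ u ++ scale G (- 1ℚ) (D-d b)
      rest≈ = ≈-trans (++-negate-restore rest (D-d b)) (++-congʳ (scale G (- 1ℚ) (D-d b)) (≈-sym u≈rest+D-d-b))

    rest-units : AllWords (λ v → suc k ℕ.≤ units v) rest
    rest-units = AllWords-++ higher _ (upper-units k u units≥k)
      (AllWords-scale (- 1ℚ) _ (AllWords-scale ι excess (upper-units k (D-d b₀)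
        (D-d-raises-units b₀ (All.map (λ eq → ℕP.≤-reflexive (sym eq)) (D-h-preserves-units lowest lowest-units))))))

    rest-size : ∀ {W} → AllWords (λ v → totalSize v ℕ.≤ W) u → AllWords (λ v → totalSize v ℕ.≤ W) rest
    rest-size u≤W = AllWords-++ higher _ (restrict-preserves unitCount (λ x → ¬? (x ℕP.≟ k)) u≤W)
      (AllWords-scale (- 1ℚ) _ (AllWords-scale ι excess (restrict-preserves unitCount (λ x → ¬? (x ℕP.≟ k))
        (D-preserves-size (dGen G) size-dGen b₀ (D-preserves-size homotopy size-homotopy lowest (restrict-preserves unitCount (ℕP._≟ k) u≤W))))))

  -- Each step raises the least number of units, which never exceeds totalSize ≤ W.
  coboundary-of-positive-units : ∀ fuel k′ {W} u → W ℕ.< suc k′ ℕ.+ fuel →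
    AllWords (λ v → suc k′ ℕ.≤ units v) u → AllWords (λ v → totalSize v ℕ.≤ W) u → D-d u ≈ [] →
    Σ (Combo G) (λ b → u ≈ D-d b)
  coboundary-of-positive-units fuel k′ [] _ _ _ _ = [] , ≈-refl
  coboundary-of-positive-units zero k′ {W} ((c , w) ∷ u) W<k (k≤w ∷ _) (w≤W ∷ _) _ =
    ⊥-elim (ℕP.<⇒≱ (subst (W ℕ.<_) (ℕP.+-identityʳ (suc k′)) W<k) (ℕP.≤-trans k≤w (ℕP.≤-trans (units≤totalSize w) w≤W)))
  coboundary-of-positive-units (suc fuel) k′ {W} u W<k units≥k u≤W du≈[] =
    b′ ++ b , ≈-trans u≈rest+D-d-b (≈-trans (++-congʳ (D-d b) rest≈D-d-b′) (≈-reflexive (sym (extend-++ (derive (dGen G)) b′ b))))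
    where
    open LowestUnits k′ u units≥k du≈[]
    rest-coboundary : Σ (Combo G) (λ b′ → rest ≈ D-d b′)
    rest-coboundary = coboundary-of-positive-units fuel (suc k′) rest (subst (W ℕ.<_) (ℕP.+-suc (suc k′) fuel) W<k)
                                                  rest-units (rest-size u≤W) D-d-rest
    b′ = proj₁ rest-coboundary
    rest≈D-d-b′ = proj₂ rest-coboundary

  -- Cocycles supported on finitely many words

  wordsUpTo : ℕ → List (Word G)
  wordsUpTo zero = [] ∷ []
  wordsUpTo (suc L) = [] ∷ List.concatMap (λ g → map (g ∷_) (wordsUpTo L)) (List.allFin (n G ℕ.+ m G))

  wordsUpTo-complete : ∀ L w → List.length w ℕ.≤ L → w ∈ wordsUpTo L
  wordsUpTo-complete zero [] _ = here refl
  wordsUpTo-complete (suc L) [] _ = here refl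
  wordsUpTo-complete (suc L) (g ∷ w) (ℕ.s≤s |w|≤L) = there (∈-concatMap⁺ (λ g → map (g ∷_) (wordsUpTo L))
    (Any.map (λ { refl → ∈-map⁺ (g ∷_) (wordsUpTo-complete L w |w|≤L) }) (∈-allFin g)))

  size-positive : ∀ g → 1 ℕ.≤ size g
  size-positive g with view g
  ... | vertex v rewrite size-vertex v = ℕ.s≤s ℕ.z≤n
  ... | edgeGen e rewrite size-edge e with edgeVertices-nonempty e
  ...   | (k , |e|≡1+k) rewrite |e|≡1+k = ℕ.s≤s ℕ.z≤n

  length≤totalSize : ∀ w → List.length w ℕ.≤ totalSize w
  length≤totalSize [] = ℕ.z≤n
  length≤totalSize (g ∷ w) = ℕP.+-mono-≤ (size-positive g) (length≤totalSize w)

  length-edgeVertices≤n : ∀ e → List.length (edgeVertices e) ℕ.≤ n G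
  length-edgeVertices≤n e = ℕP.≤-trans (ListP.length-filter _ (List.allFin (n G))) (ℕP.≤-reflexive (ListP.length-tabulate (λ i → i)))

  size≤n*deg : ∀ g → unitCount g ≡ 0 → size g ℕ.≤ n G ℕ.* deg G g
  size≤n*deg g no-unit with view g
  ... | vertex v rewrite size-vertex v | deg-vertex v | ℕP.*-identityʳ (n G) = ℕP.≤-trans (ℕ.s≤s ℕ.z≤n) (FinP.toℕ<n v)
  ... | edgeGen e rewrite size-edge e | deg-edge e | sym (length-elements (edge e)) | unitCount-edge e
    with edgeVertices e in vertices | length-edgeVertices≤n e
  ...   | [] | _ = ℕ.z≤n
  ...   | _ ∷ [] | _ with no-unit
  ...     | ()
  size≤n*deg g no-unit | edgeGen e | _ ∷ _ ∷ _ | |e|≤n =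
    ℕP.≤-trans |e|≤n (ℕP.≤-trans (ℕP.≤-reflexive (sym (ℕP.*-identityʳ (n G)))) (ℕP.*-monoʳ-≤ (n G) (ℕ.s≤s ℕ.z≤n)))

  totalSize≤n*degW : ∀ w → units w ≡ 0 → totalSize w ℕ.≤ n G ℕ.* degW G w
  totalSize≤n*degW [] _ = ℕ.z≤n
  totalSize≤n*degW (g ∷ w) no-units =
    ℕP.≤-trans (ℕP.+-mono-≤ (size≤n*deg g (ℕP.m+n≡0⇒m≡0 (unitCount g) no-units)) (totalSize≤n*degW w (ℕP.m+n≡0⇒n≡0 (unitCount g) no-units)))
               (ℕP.≤-reflexive (sym (ℕP.*-distribˡ-+ (n G) (deg G g) (degW G w))))

  toCombo : (ws : List (Word G)) → Vector (List.length ws) → Combo G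
  toCombo [] a = []
  toCombo (w ∷ ws) a = (a Fin.zero , w) ∷ toCombo ws (λ j → a (Fin.suc j))

  toCombo-cong : ∀ ws {a b} → (∀ j → a j ≡ b j) → toCombo ws a ≡ toCombo ws b
  toCombo-cong [] a≗b = refl
  toCombo-cong (w ∷ ws) a≗b = cong₂ (λ x y → (x , w) ∷ y) (a≗b Fin.zero) (toCombo-cong ws (λ j → a≗b (Fin.suc j)))

  toCombo-+ : ∀ ws a b → toCombo ws (λ j → a j + b j) ≈ toCombo ws a ++ toCombo ws b
  toCombo-+ [] a b = ≈-refl
  toCombo-+ (w ∷ ws) a b =
    ≈-trans (++-cong (monomial-+ (a Fin.zero) (b Fin.zero) w) (toCombo-+ ws _ _))
            (++-interchange (monomial (a Fin.zero) w) (monomial (b Fin.zero) w)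
                            (toCombo ws (λ j → a (Fin.suc j))) (toCombo ws (λ j → b (Fin.suc j))))

  toCombo-scale : ∀ ws c a → toCombo ws (λ j → c * a j) ≡ scale G c (toCombo ws a)
  toCombo-scale [] c a = refl
  toCombo-scale (w ∷ ws) c a = cong ((c * a Fin.zero , w) ∷_) (toCombo-scale ws c (λ j → a (Fin.suc j)))

  toCombo-zero : ∀ ws a → (∀ j → a j ≡ 0ℚ) → toCombo ws a ≈ []
  toCombo-zero [] a a≗0 = ≈-refl
  toCombo-zero (w ∷ ws) a a≗0 = ++-cong (monomial-zero w (a≗0 Fin.zero)) (toCombo-zero ws _ (λ j → a≗0 (Fin.suc j)))

  toCombo-unit : ∀ ws (j : Fin (List.length ws)) c → toCombo ws (λ k → c * unit j k) ≈ monomial c (List.lookup ws j)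
  toCombo-unit (w ∷ ws) Fin.zero c =
    ≈-trans (++-cong (monomial-coeff w (ℚP.*-identityʳ c)) (toCombo-zero ws _ (λ k → ℚP.*-zeroʳ c))) (++-identityʳ _)
  toCombo-unit (w ∷ ws) (Fin.suc j) c =
    ++-cong (monomial-zero w (ℚP.*-zeroʳ c))
            (≈-trans (≈-reflexive (toCombo-cong ws (λ k → cong (c *_) (unit-suc j k)))) (toCombo-unit ws j c))

  toCombo-combination : ∀ ws bs K → toCombo ws (combination bs K) ≈ lincomb G bs (map (toCombo ws) K)
  toCombo-combination ws [] K = toCombo-zero ws _ (λ j → refl)
  toCombo-combination ws (b ∷ bs) [] = toCombo-zero ws _ (λ j → refl)
  toCombo-combination ws (b ∷ bs) (k ∷ K) =
    ≈-trans (toCombo-+ ws (λ j → b * k j) (combination bs K))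
            (++-cong (≈-reflexive (toCombo-scale ws b k)) (toCombo-combination ws bs K))

  coordinates : ∀ ws (R : Combo G) → AllWords (_∈ ws) R → Vector (List.length ws)
  coordinates ws [] _ k = 0ℚ
  coordinates ws ((c , w) ∷ R) (w∈ws ∷ R⊆ws) k = c * unit (Any.index w∈ws) k + coordinates ws R R⊆ws k

  toCombo-coordinates : ∀ ws R R⊆ws → R ≈ toCombo ws (coordinates ws R R⊆ws)
  toCombo-coordinates ws [] _ = ≈-sym (toCombo-zero ws _ (λ k → refl))
  toCombo-coordinates ws ((c , w) ∷ R) (w∈ws ∷ R⊆ws) = ≈-sym (begin
    toCombo ws (coordinates ws ((c , w) ∷ R) (w∈ws ∷ R⊆ws))
      ≈⟨ toCombo-+ ws (λ k → c * unit (Any.index w∈ws) k) (coordinates ws R R⊆ws) ⟩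
    toCombo ws (λ k → c * unit (Any.index w∈ws) k) ++ toCombo ws (coordinates ws R R⊆ws)
      ≈⟨ ++-cong (toCombo-unit ws (Any.index w∈ws) c) (≈-sym (toCombo-coordinates ws R R⊆ws)) ⟩
    monomial c (List.lookup ws (Any.index w∈ws)) ++ R
      ≡⟨ cong (λ v → monomial c v ++ R) (sym (AnyP.lookup-index w∈ws)) ⟩
    (c , w) ∷ R ∎)
    where open ≈-Reasoning

  dRow : (ws : List (Word G)) → Word G → Vector (List.length ws)
  dRow ws mon j = coeff G (derive (dGen G) (List.lookup ws j)) mon

  coeff-D-d-toCombo : ∀ ws a mon → coeff G (D-d (toCombo ws a)) mon ≡ dRow ws mon · a
  coeff-D-d-toCombo [] a mon = refl
  coeff-D-d-toCombo (w ∷ ws) a mon =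
    trans (coeff-++ (scale G (a Fin.zero) (derive (dGen G) w)) _ mon)
          (cong₂ _+_ (coeff-scale (a Fin.zero) (derive (dGen G) w) mon) (coeff-D-d-toCombo ws (λ j → a (Fin.suc j)) mon))

  totalSizes : Combo G → ℕ
  totalSizes [] = 0
  totalSizes ((c , w) ∷ p) = totalSize w ℕ.+ totalSizes p

  totalSizes-bound : ∀ p → AllWords (λ v → totalSize v ℕ.≤ totalSizes p) p
  totalSizes-bound [] = []
  totalSizes-bound ((c , w) ∷ p) =
    ℕP.m≤m+n (totalSize w) (totalSizes p) ∷ All.map (λ le → ℕP.≤-trans le (ℕP.m≤n+m (totalSizes p) (totalSize w))) (totalSizes-bound p)

  d≈D-d : ∀ p → _≈C_ G (d G p) (D-d p)
  d≈D-d p mon = cong (λ q → coeff G q mon) (d≡D-d p)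

  D-d-restrict-size : ∀ {P : ℕ → Set} (P? : Decidable P) z → D-d z ≈ [] → D-d (restrict size P? z) ≈ []
  D-d-restrict-size P? z dz≈[] =
    subst (_≈ []) (restrict-extend-homogeneous size P? (derive (dGen G)) (derive-preserves-weight (dGen G) size size-dGen) z)
          (restrict-cong size P? dz≈[])

  module InDegree (i : ℕ) where

    sizeLimit : ℕ
    sizeLimit = n G ℕ.* i

    basisWords : List (Word G)
    basisWords = filter (λ w → degW G w ℕP.≟ i) (wordsUpTo sizeLimit)

    basisWords-degree : All (λ w → degW G w ≡ i) basisWords
    basisWords-degree = AllP.all-filter (λ w → degW G w ℕP.≟ i) (wordsUpTo sizeLimit)

    r : ℕ
    r = List.length basisWords

    monomialsOfD : List (Word G)
    monomialsOfD = List.concatMap (λ w → map proj₂ (normalTerms (derive (dGen G) w))) basisWords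

    constraints : List (Vector r)
    constraints = map (dRow basisWords) monomialsOfD

    kernel : List (Vector r)
    kernel = proj₁ (kernel-spanning-set r constraints)

    cocycleGenerators : List (Combo G)
    cocycleGenerators = map (toCombo basisWords) kernel

    dRow-∉ : ∀ mon → mon ∉ monomialsOfD → ∀ j → dRow basisWords mon j ≡ 0ℚ
    dRow-∉ mon mon∉ j = coeff-∉ (derive (dGen G) (List.lookup basisWords j)) mon λ mon∈ →
      mon∉ (∈-concatMap⁺ (λ w → map proj₂ (normalTerms (derive (dGen G) w))) (Any.map (λ { refl → mon∈ }) (∈-lookup {xs = basisWords} j)))

    toCombo-homogeneous : ∀ ws → All (λ w → degW G w ≡ i) ws → ∀ a → Homog G i (toCombo ws a)
    toCombo-homogeneous [] _ a = []
    toCombo-homogeneous (w ∷ ws) (w-deg ∷ ws-deg) a = w-deg ∷ toCombo-homogeneous ws ws-deg (λ j → a (Fin.suc j))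

    kernel-cocycle : ∀ a → a ∈ kernel → Cocycle G i (toCombo basisWords a)
    kernel-cocycle a a∈K = toCombo-homogeneous basisWords basisWords-degree a , λ mon →
      trans (d≈D-d (toCombo basisWords a) mon) (trans (coeff-D-d-toCombo basisWords a mon) (annihilated mon))
      where
      annihilated : ∀ mon → dRow basisWords mon · a ≡ 0ℚ
      annihilated mon with Any.any? (mon ≟ʷ_) monomialsOfD
      ... | yes mon∈ = All.lookup (All.lookup (proj₁ (proj₂ (kernel-spanning-set r constraints))) (∈-map⁺ (dRow basisWords) mon∈)) a∈K
      ... | no mon∉ = ·-zeroˡ (dRow basisWords mon) a (dRow-∉ mon mon∉)

    cocycleGenerators-cocycles : All (Cocycle G i) cocycleGenerators
    cocycleGenerators-cocycles = AllP.map⁺ (All.tabulate (λ {a} → kernel-cocycle a))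

    small? : Decidable (ℕ._≤ sizeLimit)
    small? = ℕP._≤? sizeLimit

    large? : Decidable (λ x → ¬ x ℕ.≤ sizeLimit)
    large? x = ¬? (small? x)

    small : Combo G → Combo G
    small = restrict size small?

    large : Combo G → Combo G
    large = restrict size large?

    large-has-units : ∀ z → Homog G i z → AllWords (λ v → 1 ℕ.≤ units v) (large z)
    large-has-units z z-deg = All.zipWith (λ {t} → has-units {proj₂ t}) (restrict-preserves size large? z-deg , restrict-satisfies size large? z)
      where
      has-units : ∀ {v} → degW G v ≡ i × ¬ totalSize v ℕ.≤ sizeLimit → 1 ℕ.≤ units v
      has-units {v} (v-deg , too-big) with units v in units-v
      ... | zero = ⊥-elim (too-big (subst (λ j → totalSize v ℕ.≤ n G ℕ.* j) v-deg (totalSize≤n*degW v units-v)))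
      ... | suc _ = ℕ.s≤s ℕ.z≤n

    large-coboundary : ∀ z → Homog G i z → D-d z ≈ [] → Σ (Combo G) (λ b → large z ≈ D-d b)
    large-coboundary z z-deg dz≈[] =
      coboundary-of-positive-units W 0 (large z) (ℕP.n<1+n W) (large-has-units z z-deg) (totalSizes-bound (large z))
        (D-d-restrict-size large? z dz≈[])
      where
      W = totalSizes (large z)

    small-in-basisWords : ∀ z → Homog G i z → AllWords (_∈ basisWords) (normalTerms (small z))
    small-in-basisWords z z-deg =
      All.map (λ {t} → in-basis {proj₂ t}) (normalTerms-AllWords stable (small z) (All.zip (restrict-preserves size small? z-deg , restrict-satisfies size small? z)))
      where
      Small : Word G → Set
      Small v = degW G v ≡ i × totalSize v ℕ.≤ sizeLimit
      stable : ∀ w {s w′} → normalize G w ≡ just (s , w′) → Small w → Small w′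
      stable w {w′ = w′} w↦ (w-deg , w-size) =
        trans (degW≡weight w′) (trans (normalize-preserves-weight (deg G) w w↦) (trans (sym (degW≡weight w)) w-deg)) ,
        subst (ℕ._≤ sizeLimit) (sym (normalize-preserves-weight size w w↦)) w-size
      in-basis : ∀ {v} → Small v → v ∈ basisWords
      in-basis {v} (v-deg , v-size) =
        ∈-filter⁺ (λ w → degW G w ℕP.≟ i) (wordsUpTo-complete sizeLimit v (ℕP.≤-trans (length≤totalSize v) v-size)) v-deg

    small-spanned : ∀ z → Homog G i z → D-d z ≈ [] → Σ (List ℚ) (λ bs → small z ≈ lincomb G bs cocycleGenerators)
    small-spanned z z-deg dz≈[] = bs , (begin
      small z                                      ≈⟨ small≈ ⟩
      toCombo basisWords a                         ≡⟨ toCombo-cong basisWords (proj₂ a-spanned) ⟩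
      toCombo basisWords (combination bs kernel)   ≈⟨ toCombo-combination basisWords bs kernel ⟩
      lincomb G bs cocycleGenerators               ∎)
      where
      open ≈-Reasoning
      a = coordinates basisWords (normalTerms (small z)) (small-in-basisWords z z-deg)
      small≈ : small z ≈ toCombo basisWords a
      small≈ = ≈-trans (≈-normalTerms (small z)) (toCombo-coordinates basisWords (normalTerms (small z)) (small-in-basisWords z z-deg))
      D-d-a≈[] : D-d (toCombo basisWords a) ≈ []
      D-d-a≈[] = ≈-trans (D-cong (dGen G) dGen-reverses-parity (≈-sym small≈)) (D-d-restrict-size small? z dz≈[])
      a-in-kernel : All (λ F → F · a ≡ 0ℚ) constraints
      a-in-kernel = AllP.map⁺ (All.universal (λ mon → trans (sym (coeff-D-d-toCombo basisWords a mon)) (coeff-≡ D-d-a≈[] mon)) monomialsOfD)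
      a-spanned = proj₂ (proj₂ (kernel-spanning-set r constraints)) a a-in-kernel
      bs = proj₁ a-spanned

    cocycle-decomposition : ∀ z → Homog G i z → D-d z ≈ [] →
      Σ (List ℚ) (λ bs → Σ (Combo G) (λ b → z ≈ lincomb G bs cocycleGenerators ++ D-d b))
    cocycle-decomposition z z-deg dz≈[] =
      proj₁ small-decomposition , proj₁ large-decomposition ,
      ≈-trans (restrict-split size small? z) (++-cong (proj₂ small-decomposition) (proj₂ large-decomposition))
      where
      small-decomposition = small-spanned z z-deg dz≈[]
      large-decomposition = large-coboundary z z-deg dz≈[]

    spans-cocycles : ∀ z → Cocycle G i z → Σ (List ℚ) (λ as → Σ (Combo G) (λ b → _≈C_ G z (lincomb G as cocycleGenerators ++ d G b)))
    spans-cocycles z (z-deg , dz≈C[]) =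
      bs , b , λ mon → trans (coeff-≡ z≈ mon) (cong (λ q → coeff G (lincomb G bs cocycleGenerators ++ q) mon) (sym (d≡D-d b)))
      where
      decomposition = cocycle-decomposition z z-deg (coeffwise λ mon → trans (sym (d≈D-d z mon)) (dz≈C[] mon))
      bs = proj₁ decomposition
      b = proj₁ (proj₂ decomposition)
      z≈ = proj₂ (proj₂ decomposition)

theorem16 : (G : Hypergraph) → (i : ℕ) → FinDimH G i
theorem16 G i = cocycleGenerators , cocycleGenerators-cocycles , spans-cocycles
  where open InDegree G i
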